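{- For every integer $k>2$, there exist at least two non-equivalent $(k^2+1,2,k,1)$-SEDFs.
   Context: Let $G$ be a finite group of order $n$ (written multiplicatively). An $(n,m,k,\lambda)$-SEDF in $G$ is a set of $m\ge2$ pairwise disjoint $k$-subsets $A_1,\ldots,A_m$ of $G$ such that for every $i$ the multiset $\{xy^{ -1}: x\in A_i, y\in \bigcup_{j\neq i}A_j\}$ contains every non-identity element of $G$ exactly $\lambda$ times. Two $(n,m,k,\lambda)$-SEDFs $\{A_1,\ldots,A_m\}$ in a group $G_1$ and $\{A'_1,\ldots,A'_m\}$ in a group $G_2$ are equivalent if there exist an isomorphism $\alpha:G_1\to G_2$ and elements $g,h\in G_2$ such that, after suitable ordering of the sets, $A'_i=h\,\alpha(A_i)\,g$ for all $i$. (In particular SEDFs in non-isomorphic groups are non-equivalent.) -}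

module Defs where

open import Data.Nat using (ℕ; zero; suc; _+_; _*_; _≤_; _<_)
open import Data.Bool using (Bool; true; false; if_then_else_; _∧_; not)
open import Data.Fin using (Fin; _≟_)
open import Data.Fin.Subset using (Subset; _∈_; _∉_; ∣_∣)
open import Data.Vec using (lookup)
open import Data.List using (List; allFin; cartesianProduct; map)
open import Data.Nat.ListAction using (sum)
open import Data.Bool.ListAction using (any)
open import Data.Product using (Σ; _×_; _,_; proj₁; proj₂; ∃)
open import Relation.Nullary using (¬_; does)
open import Relation.Binary.PropositionalEquality using (_≡_; _≢_)
open import Algebra.Structures using (IsGroup)
open import Function.Definitions using (Bijective)

-- A finite group of order n, with carrier Fin n (every finite group of
-- order n is isomorphic to such a group).
record FinGroup (n : ℕ) : Set where
  infixl 7 _·_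
  field
    _·_     : Fin n → Fin n → Fin n
    e       : Fin n
    inv     : Fin n → Fin n
    isGroup : IsGroup _≡_ _·_ e inv

record IsGroupIso {n : ℕ} (G₁ G₂ : FinGroup n) (α : Fin n → Fin n) : Set where
  private
    module G₁ = FinGroup G₁
    module G₂ = FinGroup G₂
  field
    bijective : Bijective _≡_ _≡_ α
    homo      : ∀ x y → α (x G₁.· y) ≡ α x G₂.· α y

inOthers : {n m : ℕ} → (Fin m → Subset n) → Fin m → Fin n → Bool
inOthers {m = m} A i y = any (λ j → not (does (j ≟ i)) ∧ lookup (A j) y) (allFin m)

-- multiplicity of g in the multiset {x y⁻¹ : x ∈ A i, y ∈ ⋃_{j≠i} A j}
diffCount : {n m : ℕ} → FinGroup n → (Fin m → Subset n) → Fin m → Fin n → ℕ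
diffCount {n} G A i g =
  sum (map (λ p → if lookup (A i) (proj₁ p) ∧ inOthers A i (proj₂ p)
                       ∧ does ((proj₁ p · inv (proj₂ p)) ≟ g)
                  then 1 else 0)
           (cartesianProduct (allFin n) (allFin n)))
  where open FinGroup G

record IsSEDF {n : ℕ} (G : FinGroup n) (m k λ' : ℕ) (A : Fin m → Subset n) : Set where
  open FinGroup G
  field
    two≤m    : 2 ≤ m
    size     : ∀ i → ∣ A i ∣ ≡ k
    disjoint : ∀ i j → i ≢ j → ∀ x → x ∈ A i → x ∉ A j
    diffs    : ∀ i g → g ≢ e → diffCount G A i g ≡ λ'

record SEDF (n m k λ' : ℕ) : Set where
  field
    group  : FinGroup n
    sets   : Fin m → Subset n
    isSEDF : IsSEDF group m k λ' sets

-- equivalence: an isomorphism α, elements g h of the second group and a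
-- reordering σ of the sets with A'_{σ i} = h α(A_i) g
Equivalent : {n m k λ' : ℕ} → SEDF n m k λ' → SEDF n m k λ' → Set
Equivalent {n} {m} D₁ D₂ =
  Σ (Fin n → Fin n) λ α → IsGroupIso (SEDF.group D₁) (SEDF.group D₂) α ×
  Σ (Fin n) λ g → Σ (Fin n) λ h →
  Σ (Fin m → Fin m) λ σ → Bijective _≡_ _≡_ σ ×
  (∀ i x → (x ∈ SEDF.sets D₂ (σ i) →
              Σ (Fin n) λ a → a ∈ SEDF.sets D₁ i × x ≡ h · α a · g)
         × ((Σ (Fin n) λ a → a ∈ SEDF.sets D₁ i × x ≡ h · α a · g) →
              x ∈ SEDF.sets D₂ (σ i)))
  where open FinGroup (SEDF.group D₂)

module Submission where

-- A pair of disjoint k-subsets A₀, A₁ of a group of order k² + 1 is a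
-- (k² + 1, 2, k, 1)-SEDF as soon as every non-identity element is a quotient
-- x y⁻¹ with x ∈ A₀ and y ∈ A₁: there are only k² such quotients for the k²
-- non-identity elements, so each occurs exactly once, and inverting the
-- quotients handles A₁ against A₀.  In ℤ/(k² + 1) the sets {0, …, k − 1} and
-- {k, 2k, …, k²} form such a pair.
--
-- For odd k the order k² + 1 is twice m = (k² + 1)/2, and a second SEDF lives
-- in the dihedral group of order 2m; equivalent SEDFs live in isomorphic
-- groups, and this one is not abelian.  For even k = 2t a second SEDF in
-- ℤ/(k² + 1) comes from a mixed-radix expansion of 1, …, k².  An equivalence
-- x ↦ h + α x + g maps arithmetic progressions to arithmetic progressions and
-- both standard sets are k-term progressions, but the radix set
-- {e + k s : e < 2, s < t} contains none: the digits s of its terms would form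
-- a non-constant progression of t + 1 numbers below t.

open import Defs
open import Data.Nat
  using ( ℕ; zero; suc; _+_; _*_; _∸_; _≤_; _<_; z≤n; s≤s; _%_; _/_; _≤?_
        ; NonZero; >-nonZero; >-nonZero⁻¹; ≢-nonZero⁻¹)
open import Data.Nat.Properties hiding (_≟_)
open import Data.Nat.DivMod
  using (_mod_; m<n⇒m%n≡m; %-distribˡ-+; [m+n]%n≡m%n; [m+kn]%n≡m%n; m≡m%n+[m/n]*n; m%n<n; m<n*o⇒m/o<n)
open import Data.Nat.Tactic.RingSolver using (solve-∀)
open import Data.Nat.ListAction using (sum)
open import Data.Nat.ListAction.Properties using (sum-++)
open import Algebra.Properties.Semiring.Sum +-*-semiring
  using (sum-cong-≗; sum-replicate-zero; ∑-comm; *-distribˡ-sum; *-distribʳ-sum; sum-syntax)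
  renaming (sum to ∑)
open import Data.Bool using (Bool; true; false; if_then_else_; _∧_)
open import Data.Bool.Properties using (∨-identityʳ)
open import Data.Fin using (Fin; zero; suc; _≟_; toℕ; opposite)
open import Data.Fin.Properties using (toℕ-injective; toℕ<n; toℕ-fromℕ<; opposite-involutive; *↔×)
open import Data.Fin.Subset using (Subset; _∈_; _∉_; ∣_∣; ⊥; ⁅_⁆; _∪_; ∁; inside; outside)
open import Data.Fin.Subset.Properties
  using (∉⊥; x∈⁅x⁆; x∈⁅y⁆⇒x≡y; x∈p∪q⁺; x∈p∪q⁻; ∣⁅x⁆∣≡1; ∣⊥∣≡0; ∣∁p∣≡n∸∣p∣; x∉p⇒x∈∁p; x∈∁p⇒x∉p)
open import Data.Vec using ([]; _∷_; lookup; here; there)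
open import Data.Vec.Properties using ([]=⇒lookup; lookup⇒[]=)
open import Data.List using (List; map; tabulate; cartesianProduct; allFin; _++_)
import Data.List as List
open import Data.List.Properties using (map-++; map-∘)
open import Data.Product using (Σ; ∃; ∃₂; _×_; _,_; proj₁; proj₂)
open import Data.Sum using (_⊎_; inj₁; inj₂)
open import Data.Empty using (⊥-elim)
open import Algebra.Bundles using (Group; AbelianGroup; RawGroup)
open import Algebra.Definitions using (Commutative)
open import Algebra.Structures using (IsGroup; IsAbelianGroup)
open import Algebra.Morphism.Structures using (IsGroupMonomorphism)
import Algebra.Morphism.GroupMonomorphism as GroupMonomorphism
import Algebra.Properties.Group as GroupProperties
import Algebra.Properties.AbelianGroup as AbelianGroupProperties
open import Function using (_∘_; id)
open import Function.Bundles using (_↔_; Inverse)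
open import Relation.Nullary using (¬_; yes; no; does; contradiction)
open import Relation.Nullary.Decidable using (dec-true)
open import Relation.Binary using (tri<; tri≈; tri>)
open import Relation.Binary.PropositionalEquality

m<n+1⇒m≤n : ∀ {m n} → m < n + 1 → m ≤ n
m<n+1⇒m≤n {m} {n} = m<1+n⇒m≤n ∘ subst (m <_) (+-comm n 1)

m≤n⇒m<n+1 : ∀ {m n} → m ≤ n → m < n + 1
m≤n⇒m<n+1 {m} {n} m≤n = subst (m <_) (+-comm 1 n) (s≤s m≤n)

n+1-nonZero : ∀ {n} → NonZero (n + 1)
n+1-nonZero = >-nonZero (m≤n⇒m<n+1 z≤n)

digits-unique : ∀ {K a b a′ b′} → a < K → a′ < K → a + K * b ≡ a′ + K * b′ → a ≡ a′ × b ≡ b′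
digits-unique {suc K} {a} {b} {a′} {b′} a<K a′<K eq =
  a≡a′ , *-cancelˡ-≡ b b′ (suc K) (+-cancelˡ-≡ a _ _ (trans eq (cong (_+ suc K * b′) (sym a≡a′))))
  where
  a≡a′ : a ≡ a′
  a≡a′ = begin
    a                          ≡⟨ m<n⇒m%n≡m a<K ⟨
    a % suc K                  ≡⟨ [m+kn]%n≡m%n a b (suc K) ⟨
    (a + b * suc K) % suc K    ≡⟨ cong (λ z → (a + z) % suc K) (*-comm b (suc K)) ⟩
    (a + suc K * b) % suc K    ≡⟨ cong (_% suc K) eq ⟩
    (a′ + suc K * b′) % suc K  ≡⟨ cong (λ z → (a′ + z) % suc K) (*-comm (suc K) b′) ⟩
    (a′ + b′ * suc K) % suc K  ≡⟨ [m+kn]%n≡m%n a′ b′ (suc K) ⟩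
    a′ % suc K                 ≡⟨ m<n⇒m%n≡m a′<K ⟩
    a′                         ∎
    where open ≡-Reasoning

midpoint-bit : ∀ {a b c} → a < 2 → b < 2 → c < 2 → c + a ≡ b + b → a ≡ b
midpoint-bit {0}           {0}           {_}           _              _              _              _  = refl
midpoint-bit {1}           {1}           {_}           _              _              _              _  = refl
midpoint-bit {0}           {1}           {0}           _              _              _              ()
midpoint-bit {0}           {1}           {1}           _              _              _              ()
midpoint-bit {1}           {0}           {0}           _              _              _              ()
midpoint-bit {1}           {0}           {1}           _              _              _              ()
midpoint-bit {suc (suc _)} {_}           {_}           (s≤s (s≤s ())) _              _              _
midpoint-bit {_}           {suc (suc _)} {_}           _              (s≤s (s≤s ())) _              _
midpoint-bit {_}           {_}           {suc (suc _)} _              _              (s≤s (s≤s ())) _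

nonconstant-progression-unbounded : ∀ (s : ℕ → ℕ) T →
  (∀ j → suc (suc j) ≤ T → s (suc (suc j)) + s j ≡ s (suc j) + s (suc j)) →
  s 1 ≢ s 0 → ¬ (∀ j → j ≤ T → s j < T)
nonconstant-progression-unbounded s T mid s₁≢s₀ bounded with <-cmp (s 0) (s 1)
... | tri≈ _ s₀≡s₁ _ = s₁≢s₀ (sym s₀≡s₁)
... | tri< s₀<s₁ _ _ = <-irrefl refl (≤-<-trans (j≤s T ≤-refl) (bounded T ≤-refl))
  where
  increasing : ∀ j → suc j ≤ T → s j < s (suc j)
  increasing zero    _     = s₀<s₁
  increasing (suc j) 2+j≤T = +-cancelʳ-< (s (suc j)) _ _ (begin-strict
    s (suc j) + s (suc j)         ≡⟨ mid j 2+j≤T ⟨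
    s (suc (suc j)) + s j         <⟨ +-monoʳ-< (s (suc (suc j))) (increasing j (≤-trans (n≤1+n _) 2+j≤T)) ⟩
    s (suc (suc j)) + s (suc j)   ∎)
    where open ≤-Reasoning
  j≤s : ∀ j → j ≤ T → j ≤ s j
  j≤s zero    _     = z≤n
  j≤s (suc j) 1+j≤T = ≤-trans (s≤s (j≤s j (≤-trans (n≤1+n _) 1+j≤T))) (increasing j 1+j≤T)
... | tri> _ _ s₁<s₀ = <-irrefl refl (≤-<-trans (≤-trans (m≤n+m T (s T)) (s+j≤s₀ T ≤-refl)) (bounded 0 z≤n))
  where
  decreasing : ∀ j → suc j ≤ T → s (suc j) < s j
  decreasing zero    _     = s₁<s₀
  decreasing (suc j) 2+j≤T = +-cancelʳ-< (s j) _ _ (begin-strict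
    s (suc (suc j)) + s j         ≡⟨ mid j 2+j≤T ⟩
    s (suc j) + s (suc j)         <⟨ +-monoʳ-< (s (suc j)) (decreasing j (≤-trans (n≤1+n _) 2+j≤T)) ⟩
    s (suc j) + s j               ∎)
    where open ≤-Reasoning
  s+j≤s₀ : ∀ j → j ≤ T → s j + j ≤ s 0
  s+j≤s₀ zero    _     = ≤-reflexive (+-identityʳ (s 0))
  s+j≤s₀ (suc j) 1+j≤T = begin
    s (suc j) + suc j    ≡⟨ +-suc (s (suc j)) j ⟩
    suc (s (suc j) + j)  ≤⟨ +-monoˡ-≤ j (decreasing j 1+j≤T) ⟩
    s j + j              ≤⟨ s+j≤s₀ j (≤-trans (n≤1+n _) 1+j≤T) ⟩
    s 0                  ∎
    where open ≤-Reasoning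

even-or-odd : ∀ k → (∃ λ t → k ≡ t + t) ⊎ (∃ λ q → k ≡ suc (q + q))
even-or-odd zero = inj₁ (0 , refl)
even-or-odd (suc k) with even-or-odd k
... | inj₁ (t , refl) = inj₂ (t , refl)
... | inj₂ (q , refl) = inj₁ (suc q , cong suc (sym (+-suc q q)))

𝟙 : Bool → ℕ
𝟙 b = if b then 1 else 0

∑-term≤ : ∀ {n} (f : Fin n → ℕ) i → f i ≤ ∑ f
∑-term≤ f zero    = m≤m+n _ _
∑-term≤ f (suc i) = ≤-trans (∑-term≤ (f ∘ suc) i) (m≤n+m _ _)

∑-mono-≤ : ∀ {n} {f g : Fin n → ℕ} → (∀ i → f i ≤ g i) → ∑ f ≤ ∑ g
∑-mono-≤ {zero}  f≤g = z≤n
∑-mono-≤ {suc n} f≤g = +-mono-≤ (f≤g zero) (∑-mono-≤ (f≤g ∘ suc))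

∑-tight : ∀ {n} {f g : Fin n → ℕ} → (∀ i → g i ≤ f i) → ∑ f ≤ ∑ g → ∀ i → f i ≡ g i
∑-tight {suc n} {f} {g} g≤f ∑f≤∑g = λ
  { zero    → ≤-antisym head≤ (g≤f zero)
  ; (suc i) → ∑-tight (g≤f ∘ suc) tail≤ i }
  where
  head≤ : f zero ≤ g zero
  head≤ = +-cancelʳ-≤ (∑ (f ∘ suc)) _ _
            (≤-trans ∑f≤∑g (+-monoʳ-≤ (g zero) (∑-mono-≤ (g≤f ∘ suc))))
  tail≤ : ∑ (f ∘ suc) ≤ ∑ (g ∘ suc)
  tail≤ = +-cancelˡ-≤ (f zero) _ _ (≤-trans ∑f≤∑g (+-monoˡ-≤ _ (g≤f zero)))

∣p∣≡∑𝟙 : ∀ {n} (p : Subset n) → ∣ p ∣ ≡ ∑[ x < n ] 𝟙 (lookup p x)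
∣p∣≡∑𝟙 []            = refl
∣p∣≡∑𝟙 (inside  ∷ p) = cong suc (∣p∣≡∑𝟙 p)
∣p∣≡∑𝟙 (outside ∷ p) = ∣p∣≡∑𝟙 p

∑𝟙≟≡1 : ∀ {n} (z : Fin n) → ∑[ x < n ] 𝟙 (does (z ≟ x)) ≡ 1
∑𝟙≟≡1 {suc n} zero    = cong suc (sum-replicate-zero n)
∑𝟙≟≡1 {suc n} (suc z) = ∑𝟙≟≡1 z

∑≤n∸1⇒≡1 : ∀ {n} (e : Fin n) (f : Fin n → ℕ) → ∑ f ≤ n ∸ 1 →
           (∀ x → x ≢ e → 1 ≤ f x) → ∀ x → x ≢ e → f x ≡ 1
∑≤n∸1⇒≡1 {n} e f ∑f≤n∸1 f≥1 x x≢e =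
  trans (∑-tight g≤f ∑f≤∑g x) (cong 𝟙 ([]=⇒lookup (x∉p⇒x∈∁p (x≢e ∘ x∈⁅y⁆⇒x≡y e))))
  where
  g : Fin n → ℕ
  g y = 𝟙 (lookup (∁ ⁅ e ⁆) y)
  g≤f : ∀ y → g y ≤ f y
  g≤f y with lookup (∁ ⁅ e ⁆) y in eq
  ... | false = z≤n
  ... | true  = f≥1 y (λ y≡e → x∈∁p⇒x∉p (lookup⇒[]= y _ eq) (subst (_∈ ⁅ e ⁆) (sym y≡e) (x∈⁅x⁆ e)))
  ∑f≤∑g : ∑ f ≤ ∑ g
  ∑f≤∑g = begin
    ∑ f              ≤⟨ ∑f≤n∸1 ⟩
    n ∸ 1            ≡⟨ cong (n ∸_) (∣⁅x⁆∣≡1 e) ⟨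
    n ∸ ∣ ⁅ e ⁆ ∣    ≡⟨ ∣∁p∣≡n∸∣p∣ ⁅ e ⁆ ⟨
    ∣ ∁ ⁅ e ⁆ ∣      ≡⟨ ∣p∣≡∑𝟙 (∁ ⁅ e ⁆) ⟩
    ∑ g              ∎
    where open ≤-Reasoning

sum-map-tabulate : ∀ {n} {A : Set} (f : Fin n → A) (h : A → ℕ) →
                   sum (map h (tabulate f)) ≡ ∑ (h ∘ f)
sum-map-tabulate {zero}  f h = refl
sum-map-tabulate {suc n} f h = cong (h (f zero) +_) (sum-map-tabulate (f ∘ suc) h)

sum-map-cartesianProduct : ∀ {A B : Set} (h : A × B → ℕ) (xs : List A) (ys : List B) →
  sum (map h (cartesianProduct xs ys)) ≡ sum (map (λ x → sum (map (λ y → h (x , y)) ys)) xs)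
sum-map-cartesianProduct h List.[]       ys = refl
sum-map-cartesianProduct h (x List.∷ xs) ys = begin
  sum (map h (map (x ,_) ys ++ cartesianProduct xs ys))
    ≡⟨ cong sum (map-++ h (map (x ,_) ys) (cartesianProduct xs ys)) ⟩
  sum (map h (map (x ,_) ys) ++ map h (cartesianProduct xs ys))
    ≡⟨ sum-++ (map h (map (x ,_) ys)) _ ⟩
  sum (map h (map (x ,_) ys)) + sum (map h (cartesianProduct xs ys))
    ≡⟨ cong₂ _+_ (cong sum (sym (map-∘ ys))) (sum-map-cartesianProduct h xs ys) ⟩
  sum (map (λ y → h (x , y)) ys) + sum (map (λ x → sum (map (λ y → h (x , y)) ys)) xs) ∎
  where open ≡-Reasoning

sum-map-allFin² : ∀ {n} (h : Fin n × Fin n → ℕ) →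
  sum (map h (cartesianProduct (allFin n) (allFin n))) ≡ ∑[ x < n ] ∑[ y < n ] h (x , y)
sum-map-allFin² {n} h = begin
  sum (map h (cartesianProduct (allFin n) (allFin n)))
    ≡⟨ sum-map-cartesianProduct h (allFin n) (allFin n) ⟩
  sum (map (λ x → sum (map (λ y → h (x , y)) (allFin n))) (allFin n))
    ≡⟨ sum-map-tabulate {n} id _ ⟩
  ∑[ x < n ] sum (map (λ y → h (x , y)) (allFin n))
    ≡⟨ sum-cong-≗ {n} (λ x → sum-map-tabulate {n} id _) ⟩
  ∑[ x < n ] ∑[ y < n ] h (x , y) ∎
  where open ≡-Reasoning

∣p∪q∣≡∣p∣+∣q∣ : ∀ {n} (p q : Subset n) → (∀ x → x ∈ p → x ∉ q) → ∣ p ∪ q ∣ ≡ ∣ p ∣ + ∣ q ∣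
∣p∪q∣≡∣p∣+∣q∣ []            []            disj = refl
∣p∪q∣≡∣p∣+∣q∣ (inside  ∷ p) (inside  ∷ q) disj = contradiction here (disj zero here)
∣p∪q∣≡∣p∣+∣q∣ (inside  ∷ p) (outside ∷ q) disj =
  cong suc (∣p∪q∣≡∣p∣+∣q∣ p q (λ x x∈p x∈q → disj (suc x) (there x∈p) (there x∈q)))
∣p∪q∣≡∣p∣+∣q∣ (outside ∷ p) (inside  ∷ q) disj =
  trans (cong suc (∣p∪q∣≡∣p∣+∣q∣ p q (λ x x∈p x∈q → disj (suc x) (there x∈p) (there x∈q))))
        (sym (+-suc ∣ p ∣ ∣ q ∣))
∣p∪q∣≡∣p∣+∣q∣ (outside ∷ p) (outside ∷ q) disj =
  ∣p∪q∣≡∣p∣+∣q∣ p q (λ x x∈p x∈q → disj (suc x) (there x∈p) (there x∈q))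

image : ∀ {n} → (ℕ → Fin n) → ℕ → Subset n
image f zero    = ⊥
image f (suc K) = ⁅ f K ⁆ ∪ image f K

∈image⁺ : ∀ {n} (f : ℕ → Fin n) {K j} → j < K → f j ∈ image f K
∈image⁺ f {suc K} {j} j<1+K with m<1+n⇒m<n∨m≡n j<1+K
... | inj₁ j<K  = x∈p∪q⁺ (inj₂ (∈image⁺ f j<K))
... | inj₂ refl = x∈p∪q⁺ (inj₁ (x∈⁅x⁆ (f j)))

∈image⁻ : ∀ {n} (f : ℕ → Fin n) K {x} → x ∈ image f K → ∃ λ j → j < K × f j ≡ x
∈image⁻ f zero    x∈ = contradiction x∈ ∉⊥
∈image⁻ f (suc K) x∈ with x∈p∪q⁻ ⁅ f K ⁆ (image f K) x∈
... | inj₁ x∈⁅fK⁆ = K , ≤-refl , sym (x∈⁅y⁆⇒x≡y (f K) x∈⁅fK⁆)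
... | inj₂ x∈img  = let j , j<K , fj≡x = ∈image⁻ f K x∈img in j , m<n⇒m<1+n j<K , fj≡x

∣image∣≡ : ∀ {n} (f : ℕ → Fin n) K →
           (∀ {i j} → i < K → j < K → f i ≡ f j → i ≡ j) → ∣ image f K ∣ ≡ K
∣image∣≡ {n} f zero    f-inj = ∣⊥∣≡0 n
∣image∣≡     f (suc K) f-inj = begin
  ∣ ⁅ f K ⁆ ∪ image f K ∣       ≡⟨ ∣p∪q∣≡∣p∣+∣q∣ ⁅ f K ⁆ (image f K) fresh ⟩
  ∣ ⁅ f K ⁆ ∣ + ∣ image f K ∣   ≡⟨ cong₂ _+_ (∣⁅x⁆∣≡1 (f K)) (∣image∣≡ f K f-inj′) ⟩
  suc K                        ∎
  where
  open ≡-Reasoning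
  f-inj′ : ∀ {i j} → i < K → j < K → f i ≡ f j → i ≡ j
  f-inj′ i<K j<K = f-inj (m<n⇒m<1+n i<K) (m<n⇒m<1+n j<K)
  fresh : ∀ x → x ∈ ⁅ f K ⁆ → x ∉ image f K
  fresh x x∈⁅fK⁆ x∈img with ∈image⁻ f K x∈img
  ... | j , j<K , fj≡x = <-irrefl (f-inj (m<n⇒m<1+n j<K) ≤-refl (trans fj≡x (x∈⁅y⁆⇒x≡y (f K) x∈⁅fK⁆))) j<K

∣image∪image∣≡ : ∀ {n} (f g : ℕ → Fin n) K L →
  (∀ {i j} → i < K → j < K → f i ≡ f j → i ≡ j) →
  (∀ {i j} → i < L → j < L → g i ≡ g j → i ≡ j) →
  (∀ {i j} → i < K → j < L → f i ≢ g j) →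
  ∣ image f K ∪ image g L ∣ ≡ K + L
∣image∪image∣≡ f g K L f-inj g-inj f≢g = begin
  ∣ image f K ∪ image g L ∣          ≡⟨ ∣p∪q∣≡∣p∣+∣q∣ (image f K) (image g L) disjoint ⟩
  ∣ image f K ∣ + ∣ image g L ∣      ≡⟨ cong₂ _+_ (∣image∣≡ f K f-inj) (∣image∣≡ g L g-inj) ⟩
  K + L                              ∎
  where
  open ≡-Reasoning
  disjoint : ∀ x → x ∈ image f K → x ∉ image g L
  disjoint x x∈f x∈g with ∈image⁻ f K x∈f | ∈image⁻ g L x∈g
  ... | i , i<K , refl | j , j<L , gj≡fi = f≢g i<K j<L (sym gj≡fi)

-- SEDFs from difference covers

asGroup : ∀ {n} → FinGroup n → Group _ _
asGroup G = record { isGroup = FinGroup.isGroup G }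

IsDifference : ∀ {n} → FinGroup n → Subset n → Subset n → Fin n → Set
IsDifference G A B g = ∃₂ λ x y → x ∈ A × y ∈ B × x · inv y ≡ g
  where open FinGroup G

CoversDifferences : ∀ {n} → FinGroup n → Subset n → Subset n → Set
CoversDifferences G A B = ∀ g → g ≢ FinGroup.e G → IsDifference G A B g

CoversDifferences-swap : ∀ {n} (G : FinGroup n) {A B : Subset n} →
                         CoversDifferences G A B → CoversDifferences G B A
CoversDifferences-swap G cover g g≢e =
  let x , y , x∈A , y∈B , xy⁻¹≡g⁻¹ = cover (inv g) g⁻¹≢e
  in  y , x , y∈B , x∈A , (begin
        y · inv x          ≡⟨ ⁻¹-anti-homo-// x y ⟨
        inv (x · inv y)    ≡⟨ cong inv xy⁻¹≡g⁻¹ ⟩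
        inv (inv g)        ≡⟨ ⁻¹-involutive g ⟩
        g                  ∎)
  where
  open FinGroup G
  open GroupProperties (asGroup G)
  open ≡-Reasoning
  g⁻¹≢e : inv g ≢ e
  g⁻¹≢e g⁻¹≡e = g≢e (⁻¹-injective (trans g⁻¹≡e (sym ε⁻¹≈ε)))

module _ {n} (G : FinGroup n) (A : Fin 2 → Subset n) where
  open FinGroup G

  private
    inOthers≡ : ∀ i y → inOthers A i y ≡ lookup (A (opposite i)) y
    inOthers≡ zero       y = ∨-identityʳ _
    inOthers≡ (suc zero) y = ∨-identityʳ _

    term : Fin 2 → Fin n → Fin n → Fin n → ℕ
    term i g x y = 𝟙 (lookup (A i) x ∧ inOthers A i y ∧ does (x · inv y ≟ g))

  diffCount≡∑∑ : ∀ i g → diffCount G A i g ≡ ∑[ x < n ] ∑[ y < n ] term i g x y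
  diffCount≡∑∑ i g = sum-map-allFin² {n} _

  ∑-diffCount : ∀ i → ∑[ g < n ] diffCount G A i g ≡ ∣ A i ∣ * ∣ A (opposite i) ∣
  ∑-diffCount i = begin
    ∑[ g < n ] diffCount G A i g                    ≡⟨ sum-cong-≗ {n} (diffCount≡∑∑ i) ⟩
    ∑[ g < n ] ∑[ x < n ] ∑[ y < n ] term i g x y   ≡⟨ ∑-comm (λ g x → ∑[ y < n ] term i g x y) ⟩
    ∑[ x < n ] ∑[ g < n ] ∑[ y < n ] term i g x y   ≡⟨ sum-cong-≗ {n} (λ x → ∑-comm (λ g y → term i g x y)) ⟩
    ∑[ x < n ] ∑[ y < n ] ∑[ g < n ] term i g x y   ≡⟨ sum-cong-≗ {n} (λ x → sum-cong-≗ {n} (∑-term x)) ⟩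
    ∑[ x < n ] ∑[ y < n ] (a x * b y)               ≡⟨ sum-cong-≗ {n} (λ x → *-distribˡ-sum (a x) b) ⟨
    ∑[ x < n ] (a x * ∑ b)                          ≡⟨ *-distribʳ-sum (∑ b) a ⟨
    ∑ a * ∑ b                                       ≡⟨ cong₂ _*_ (∣p∣≡∑𝟙 (A i)) (∣p∣≡∑𝟙 (A (opposite i))) ⟨
    ∣ A i ∣ * ∣ A (opposite i) ∣                    ∎
    where
    open ≡-Reasoning
    a b : Fin n → ℕ
    a x = 𝟙 (lookup (A i) x)
    b y = 𝟙 (lookup (A (opposite i)) y)
    ∑-term : ∀ x y → ∑[ g < n ] term i g x y ≡ a x * b y
    ∑-term x y rewrite inOthers≡ i y with lookup (A i) x | lookup (A (opposite i)) y
    ... | true  | true  = ∑𝟙≟≡1 (x · inv y)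
    ... | true  | false = sum-replicate-zero n
    ... | false | _     = sum-replicate-zero n

  diffCount≥1 : ∀ i → CoversDifferences G (A i) (A (opposite i)) → ∀ g → g ≢ e → 1 ≤ diffCount G A i g
  diffCount≥1 i cover g g≢e with cover g g≢e
  ... | x , y , x∈A , y∈B , xy⁻¹≡g = begin
    1                                     ≡⟨ term≡1 ⟨
    term i g x y                          ≤⟨ ∑-term≤ (term i g x) y ⟩
    ∑[ y < n ] term i g x y               ≤⟨ ∑-term≤ (λ x → ∑[ y < n ] term i g x y) x ⟩
    ∑[ x < n ] ∑[ y < n ] term i g x y    ≡⟨ diffCount≡∑∑ i g ⟨
    diffCount G A i g                     ∎
    where
    open ≤-Reasoning
    term≡1 : term i g x y ≡ 1
    term≡1 rewrite []=⇒lookup x∈A | inOthers≡ i y | []=⇒lookup y∈B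
                 | dec-true (x · inv y ≟ g) xy⁻¹≡g = refl

isSEDF-fromCover : ∀ {k} (G : FinGroup (k * k + 1)) (A : Fin 2 → Subset (k * k + 1)) →
                   (∀ i → ∣ A i ∣ ≡ k) → (∀ x → x ∈ A zero → x ∉ A (suc zero)) →
                   CoversDifferences G (A zero) (A (suc zero)) → IsSEDF G 2 k 1 A
isSEDF-fromCover {k} G A size disjoint cover = record
  { two≤m    = s≤s (s≤s z≤n)
  ; size     = size
  ; disjoint = disjoint′
  ; diffs    = λ i → ∑≤n∸1⇒≡1 e (diffCount G A i) (∑-diffCount≤ i) (diffCount≥1 G A i (covers i))
  }
  where
  open FinGroup G
  disjoint′ : ∀ i j → i ≢ j → ∀ x → x ∈ A i → x ∉ A j
  disjoint′ zero       zero       i≢j = ⊥-elim (i≢j refl)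
  disjoint′ zero       (suc zero) _   = disjoint
  disjoint′ (suc zero) zero       _   = λ x x∈A₁ x∈A₀ → disjoint x x∈A₀ x∈A₁
  disjoint′ (suc zero) (suc zero) i≢j = ⊥-elim (i≢j refl)
  covers : ∀ i → CoversDifferences G (A i) (A (opposite i))
  covers zero       = cover
  covers (suc zero) = CoversDifferences-swap G cover
  ∑-diffCount≤ : ∀ i → ∑[ g < k * k + 1 ] diffCount G A i g ≤ k * k + 1 ∸ 1
  ∑-diffCount≤ i = ≤-reflexive (begin
    ∑[ g < k * k + 1 ] diffCount G A i g   ≡⟨ ∑-diffCount G A i ⟩
    ∣ A i ∣ * ∣ A (opposite i) ∣           ≡⟨ cong₂ _*_ (size i) (size (opposite i)) ⟩
    k * k                                  ≡⟨ m+n∸n≡m (k * k) 1 ⟨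
    k * k + 1 ∸ 1                          ∎)
    where open ≡-Reasoning

-- Isomorphisms and progressions

module _ {n} {G₁ G₂ : FinGroup n} {α : Fin n → Fin n} (iso : IsGroupIso G₁ G₂ α) where
  private
    module G₁ = FinGroup G₁
    module G₂ = FinGroup G₂
  open IsGroupIso iso

  iso-identity : α G₁.e ≡ G₂.e
  iso-identity = identityʳ-unique (α G₁.e) (α G₁.e) (begin
    α G₁.e G₂.· α G₁.e    ≡⟨ homo G₁.e G₁.e ⟨
    α (G₁.e G₁.· G₁.e)    ≡⟨ cong α (IsGroup.identityˡ G₁.isGroup G₁.e) ⟩
    α G₁.e                ∎)
    where
    open ≡-Reasoning
    open GroupProperties (asGroup G₂) using (identityʳ-unique)

  iso-comm : Commutative _≡_ G₁._·_ → Commutative _≡_ G₂._·_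
  iso-comm comm₁ x y = begin
    x G₂.· y                 ≡⟨ cong₂ G₂._·_ (α-preimage x) (α-preimage y) ⟨
    α a G₂.· α b             ≡⟨ homo a b ⟨
    α (a G₁.· b)             ≡⟨ cong α (comm₁ a b) ⟩
    α (b G₁.· a)             ≡⟨ homo b a ⟩
    α b G₂.· α a             ≡⟨ cong₂ G₂._·_ (α-preimage y) (α-preimage x) ⟩
    y G₂.· x                 ∎
    where
    open ≡-Reasoning
    α-preimage : ∀ z → α (proj₁ (proj₂ bijective z)) ≡ z
    α-preimage z = proj₂ (proj₂ bijective z) refl
    a = proj₁ (proj₂ bijective x)
    b = proj₁ (proj₂ bijective y)

record Progression {n} (G : FinGroup n) (len : ℕ) (S : Subset n) : Set where
  open FinGroup G
  field
    term     : ℕ → Fin n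
    step     : Fin n
    step≢e   : step ≢ e
    term-suc : ∀ j → term (suc j) ≡ term j · step
    term∈    : ∀ {j} → j < len → term j ∈ S

progression-image : ∀ {n} {G₁ G₂ : FinGroup n} {α} → IsGroupIso G₁ G₂ α →
  let open FinGroup G₂ in Commutative _≡_ _·_ → ∀ h g {len S₁ S₂} →
  (∀ x → x ∈ S₁ → h · α x · g ∈ S₂) → Progression G₁ len S₁ → Progression G₂ len S₂
progression-image {G₁ = G₁} {G₂} {α} iso comm₂ h g image⊆ P = record
  { term     = λ j → h · α (term j) · g
  ; step     = α step
  ; step≢e   = λ αstep≡e → step≢e (proj₁ bijective (trans αstep≡e (sym (iso-identity iso))))
  ; term-suc = λ j → begin
      h · α (term (suc j)) · g          ≡⟨ cong (λ z → h · α z · g) (term-suc j) ⟩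
      h · α (term j G₁.· step) · g      ≡⟨ cong (λ z → h · z · g) (homo (term j) step) ⟩
      h · (α (term j) · α step) · g     ≡⟨ cong (_· g) (assoc h (α (term j)) (α step)) ⟨
      h · α (term j) · α step · g       ≡⟨ assoc (h · α (term j)) (α step) g ⟩
      h · α (term j) · (α step · g)     ≡⟨ cong (h · α (term j) ·_) (comm₂ (α step) g) ⟩
      h · α (term j) · (g · α step)     ≡⟨ assoc (h · α (term j)) g (α step) ⟨
      h · α (term j) · g · α step       ∎
  ; term∈    = λ j<len → image⊆ _ (term∈ j<len)
  }
  where
  module G₁ = FinGroup G₁
  open Progression P
  open IsGroupIso iso
  open FinGroup G₂
  open IsGroup isGroup using (assoc)
  open ≡-Reasoning

progression-midpoint : ∀ {n} {G : FinGroup n} {len S} → Commutative _≡_ (FinGroup._·_ G) →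
  (P : Progression G len S) → let open FinGroup G; open Progression P in
  ∀ j → term (suc (suc j)) · term j ≡ term (suc j) · term (suc j)
progression-midpoint {G = G} comm P j = begin
  term (suc (suc j)) · term j       ≡⟨ cong (_· term j) (term-suc (suc j)) ⟩
  term (suc j) · step · term j      ≡⟨ assoc (term (suc j)) step (term j) ⟩
  term (suc j) · (step · term j)    ≡⟨ cong (term (suc j) ·_) (comm step (term j)) ⟩
  term (suc j) · (term j · step)    ≡⟨ cong (term (suc j) ·_) (term-suc j) ⟨
  term (suc j) · term (suc j)       ∎
  where
  open FinGroup G
  open Progression P
  open IsGroup isGroup using (assoc)
  open ≡-Reasoning

equivalent-progression : ∀ {n m k λ'} {D₁ D₂ : SEDF n m k λ'} → Equivalent D₁ D₂ →
  Commutative _≡_ (FinGroup._·_ (SEDF.group D₂)) →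
  ∀ {len} → (∀ i → Progression (SEDF.group D₁) len (SEDF.sets D₁ i)) →
  ∀ j → Progression (SEDF.group D₂) len (SEDF.sets D₂ j)
equivalent-progression {D₂ = D₂} (α , iso , g , h , σ , (_ , σ-surjective) , σ-maps) comm P j =
  subst (Progression (SEDF.group D₂) _ ∘ SEDF.sets D₂) (proj₂ (σ-surjective j) refl)
        (progression-image iso comm h g (λ x x∈ → proj₂ (σ-maps i _) (x , x∈ , refl)) (P i))
  where i = proj₁ (σ-surjective j)

equivalent-comm : ∀ {n m k λ'} {D₁ D₂ : SEDF n m k λ'} → Equivalent D₁ D₂ →
  Commutative _≡_ (FinGroup._·_ (SEDF.group D₁)) → Commutative _≡_ (FinGroup._·_ (SEDF.group D₂))
equivalent-comm (_ , iso , _) = iso-comm iso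

-- Cyclic and dihedral groups

module Cyclic (N : ℕ) .{{_ : NonZero N}} where

  infixl 6 _⊕_
  infix  8 ⊖_

  ⟦_⟧ : ℕ → Fin N
  ⟦ a ⟧ = a mod N

  _⊕_ : Fin N → Fin N → Fin N
  x ⊕ y = ⟦ toℕ x + toℕ y ⟧

  ⊖_ : Fin N → Fin N
  ⊖ x = ⟦ N ∸ toℕ x ⟧

  𝟘 : Fin N
  𝟘 = ⟦ 0 ⟧

  toℕ-⟦⟧ : ∀ a → toℕ ⟦ a ⟧ ≡ a % N
  toℕ-⟦⟧ a = toℕ-fromℕ< _

  toℕ-⟦⟧< : ∀ {a} → a < N → toℕ ⟦ a ⟧ ≡ a
  toℕ-⟦⟧< a<N = trans (toℕ-⟦⟧ _) (m<n⇒m%n≡m a<N)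

  ⟦toℕ⟧ : ∀ x → ⟦ toℕ x ⟧ ≡ x
  ⟦toℕ⟧ x = toℕ-injective (toℕ-⟦⟧< (toℕ<n x))

  ⟦⟧-≡ : ∀ {a b} → a % N ≡ b % N → ⟦ a ⟧ ≡ ⟦ b ⟧
  ⟦⟧-≡ {a} {b} a≡b = toℕ-injective (trans (toℕ-⟦⟧ a) (trans a≡b (sym (toℕ-⟦⟧ b))))

  ⟦⟧-injective : ∀ {a b} → a < N → b < N → ⟦ a ⟧ ≡ ⟦ b ⟧ → a ≡ b
  ⟦⟧-injective a<N b<N eq = trans (sym (toℕ-⟦⟧< a<N)) (trans (cong toℕ eq) (toℕ-⟦⟧< b<N))

  ⟦⟧-homo-+ : ∀ a b → ⟦ a + b ⟧ ≡ ⟦ a ⟧ ⊕ ⟦ b ⟧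
  ⟦⟧-homo-+ a b = ⟦⟧-≡ (trans (%-distribˡ-+ a b N) (sym (cong₂ (λ u v → (u + v) % N) (toℕ-⟦⟧ a) (toℕ-⟦⟧ b))))

  ⟦a+N⟧≡⟦a⟧ : ∀ a → ⟦ a + N ⟧ ≡ ⟦ a ⟧
  ⟦a+N⟧≡⟦a⟧ a = ⟦⟧-≡ ([m+n]%n≡m%n a N)

  ⟦suc⟧-onto-≢𝟘 : ∀ x → x ≢ 𝟘 → ∃ λ r → suc r < N × ⟦ suc r ⟧ ≡ x
  ⟦suc⟧-onto-≢𝟘 x x≢𝟘 with toℕ x in eq
  ... | zero  = contradiction (trans (sym (⟦toℕ⟧ x)) (cong ⟦_⟧ eq)) x≢𝟘
  ... | suc r = r , subst (_< N) eq (toℕ<n x) , subst (λ t → ⟦ t ⟧ ≡ x) eq (⟦toℕ⟧ x)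

  ⊕-assoc : ∀ x y z → (x ⊕ y) ⊕ z ≡ x ⊕ (y ⊕ z)
  ⊕-assoc x y z = begin
    ⟦ toℕ x + toℕ y ⟧ ⊕ z               ≡⟨ cong (⟦ toℕ x + toℕ y ⟧ ⊕_) (⟦toℕ⟧ z) ⟨
    ⟦ toℕ x + toℕ y ⟧ ⊕ ⟦ toℕ z ⟧       ≡⟨ ⟦⟧-homo-+ (toℕ x + toℕ y) (toℕ z) ⟨
    ⟦ toℕ x + toℕ y + toℕ z ⟧           ≡⟨ cong ⟦_⟧ (+-assoc (toℕ x) (toℕ y) (toℕ z)) ⟩
    ⟦ toℕ x + (toℕ y + toℕ z) ⟧         ≡⟨ ⟦⟧-homo-+ (toℕ x) (toℕ y + toℕ z) ⟩
    ⟦ toℕ x ⟧ ⊕ ⟦ toℕ y + toℕ z ⟧       ≡⟨ cong (_⊕ (y ⊕ z)) (⟦toℕ⟧ x) ⟩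
    x ⊕ (y ⊕ z)                         ∎
    where open ≡-Reasoning

  ⊕-comm : ∀ x y → x ⊕ y ≡ y ⊕ x
  ⊕-comm x y = cong ⟦_⟧ (+-comm (toℕ x) (toℕ y))

  ⊕-identityˡ : ∀ x → 𝟘 ⊕ x ≡ x
  ⊕-identityˡ x = trans (cong ⟦_⟧ (cong (_+ toℕ x) (toℕ-⟦⟧< (>-nonZero⁻¹ N)))) (⟦toℕ⟧ x)

  ⊕-identityʳ : ∀ x → x ⊕ 𝟘 ≡ x
  ⊕-identityʳ x = trans (⊕-comm x 𝟘) (⊕-identityˡ x)

  ⊕-inverseˡ : ∀ x → ⊖ x ⊕ x ≡ 𝟘
  ⊕-inverseˡ x = begin
    ⊖ x ⊕ x                           ≡⟨ cong (⊖ x ⊕_) (⟦toℕ⟧ x) ⟨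
    ⟦ N ∸ toℕ x ⟧ ⊕ ⟦ toℕ x ⟧         ≡⟨ ⟦⟧-homo-+ (N ∸ toℕ x) (toℕ x) ⟨
    ⟦ N ∸ toℕ x + toℕ x ⟧             ≡⟨ cong ⟦_⟧ (m∸n+n≡m (<⇒≤ (toℕ<n x))) ⟩
    ⟦ N ⟧                             ≡⟨ ⟦a+N⟧≡⟦a⟧ 0 ⟩
    𝟘                                 ∎
    where open ≡-Reasoning

  ⊕-inverseʳ : ∀ x → x ⊕ ⊖ x ≡ 𝟘
  ⊕-inverseʳ x = trans (⊕-comm x (⊖ x)) (⊕-inverseˡ x)

  isAbelianGroup : IsAbelianGroup _≡_ _⊕_ 𝟘 ⊖_
  isAbelianGroup = record
    { isGroup = record
      { isMonoid = record
        { isSemigroup = record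
          { isMagma = record { isEquivalence = isEquivalence ; ∙-cong = cong₂ _⊕_ }
          ; assoc   = ⊕-assoc }
        ; identity = ⊕-identityˡ , ⊕-identityʳ }
      ; inverse = ⊕-inverseˡ , ⊕-inverseʳ
      ; ⁻¹-cong = cong ⊖_ }
    ; comm = ⊕-comm }

  abelianGroup : AbelianGroup _ _
  abelianGroup = record { isAbelianGroup = isAbelianGroup }

  cyclicGroup : FinGroup N
  cyclicGroup = record { isGroup = IsAbelianGroup.isGroup isAbelianGroup }

  open AbelianGroupProperties abelianGroup public
    using (⁻¹-involutive; ⁻¹-injective; ε⁻¹≈ε; ⁻¹-∙-comm)

  ⊕⊖-cancel : ∀ {x y z} → x ≡ z ⊕ y → x ⊕ ⊖ y ≡ z
  ⊕⊖-cancel {y = y} {z} refl = begin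
    z ⊕ y ⊕ ⊖ y       ≡⟨ ⊕-assoc z y (⊖ y) ⟩
    z ⊕ (y ⊕ ⊖ y)     ≡⟨ cong (z ⊕_) (⊕-inverseʳ y) ⟩
    z ⊕ 𝟘             ≡⟨ ⊕-identityʳ z ⟩
    z                 ∎
    where open ≡-Reasoning

  ⟦a⟧≡⊖⟦b⟧⇒a+b≡0 : ∀ {a b} → a + b < N → ⟦ a ⟧ ≡ ⊖ ⟦ b ⟧ → a + b ≡ 0
  ⟦a⟧≡⊖⟦b⟧⇒a+b≡0 {a} {b} a+b<N ⟦a⟧≡⊖⟦b⟧ = ⟦⟧-injective a+b<N (>-nonZero⁻¹ N) (begin
    ⟦ a + b ⟧           ≡⟨ ⟦⟧-homo-+ a b ⟩
    ⟦ a ⟧ ⊕ ⟦ b ⟧       ≡⟨ cong (_⊕ ⟦ b ⟧) ⟦a⟧≡⊖⟦b⟧ ⟩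
    ⊖ ⟦ b ⟧ ⊕ ⟦ b ⟧     ≡⟨ ⊕-inverseˡ ⟦ b ⟧ ⟩
    𝟘                   ∎)
    where open ≡-Reasoning

module Transport {n} {X : Set} (f : Fin n ↔ X) {_∙_ : X → X → X} {ε : X} {_⁻¹ : X → X}
                 (isGroup : IsGroup _≡_ _∙_ ε _⁻¹) where
  open Inverse f

  private
    raw : RawGroup _ _
    raw = record { _≈_ = _≡_ ; _∙_ = λ x y → from (to x ∙ to y) ; ε = from ε ; _⁻¹ = λ x → from (to x ⁻¹) }

    rawX : RawGroup _ _
    rawX = record { _≈_ = _≡_ ; _∙_ = _∙_ ; ε = ε ; _⁻¹ = _⁻¹ }

    to-isGroupMonomorphism : IsGroupMonomorphism raw rawX to
    to-isGroupMonomorphism = record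
      { isGroupHomomorphism = record
        { isMonoidHomomorphism = record
          { isMagmaHomomorphism = record
            { isRelHomomorphism = record { cong = cong to }
            ; homo              = λ x y → strictlyInverseˡ (to x ∙ to y) }
          ; ε-homo = strictlyInverseˡ ε }
        ; ⁻¹-homo = λ x → strictlyInverseˡ (to x ⁻¹) }
      ; injective = λ {x} {y} to-x≡to-y →
          trans (sym (strictlyInverseʳ x)) (trans (cong from to-x≡to-y) (strictlyInverseʳ y))
      }

  transportedGroup : FinGroup n
  transportedGroup = record { isGroup = GroupMonomorphism.isGroup to-isGroupMonomorphism isGroup }

  open FinGroup transportedGroup

  from-injective : ∀ {x y} → from x ≡ from y → x ≡ y
  from-injective {x} {y} eq = trans (sym (strictlyInverseˡ x)) (trans (cong to eq) (strictlyInverseˡ y))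

  from-homo : ∀ x y → from x · from y ≡ from (x ∙ y)
  from-homo x y = cong₂ (λ u v → from (u ∙ v)) (strictlyInverseˡ x) (strictlyInverseˡ y)

  from-homo-inv : ∀ x y → from x · inv (from y) ≡ from (x ∙ (y ⁻¹))
  from-homo-inv x y = trans (cong (from x ·_) (cong from (cong _⁻¹ (strictlyInverseˡ y))))
                            (from-homo x (y ⁻¹))

-- (zero , a) stands for ρᵃ and (suc zero , a) for ρᵃ τ, where τ² = 1 and τ ρ τ = ρ⁻¹.
module Dihedral (m : ℕ) .{{_ : NonZero m}} where
  open Cyclic m

  infixl 7 _⋆_
  infix  8 _⁻¹

  _⋆_ : Fin 2 × Fin m → Fin 2 × Fin m → Fin 2 × Fin m
  (zero     , a) ⋆ (s , b) = s , a ⊕ b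
  (suc zero , a) ⋆ (s , b) = opposite s , a ⊕ ⊖ b

  _⁻¹ : Fin 2 × Fin m → Fin 2 × Fin m
  (zero     , a) ⁻¹ = zero , ⊖ a
  (suc zero , a) ⁻¹ = suc zero , a

  ι : Fin 2 × Fin m
  ι = zero , 𝟘

  ⋆-assoc : ∀ x y z → x ⋆ y ⋆ z ≡ x ⋆ (y ⋆ z)
  ⋆-assoc (zero     , a) (zero     , b) (s , c) = cong (s ,_) (⊕-assoc a b c)
  ⋆-assoc (zero     , a) (suc zero , b) (s , c) = cong (opposite s ,_) (⊕-assoc a b (⊖ c))
  ⋆-assoc (suc zero , a) (zero     , b) (s , c) = cong (opposite s ,_) (begin
    a ⊕ ⊖ b ⊕ ⊖ c        ≡⟨ ⊕-assoc a (⊖ b) (⊖ c) ⟩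
    a ⊕ (⊖ b ⊕ ⊖ c)      ≡⟨ cong (a ⊕_) (⁻¹-∙-comm b c) ⟩
    a ⊕ ⊖ (b ⊕ c)        ∎)
    where open ≡-Reasoning
  ⋆-assoc (suc zero , a) (suc zero , b) (s , c) = cong₂ _,_ (sym (opposite-involutive s)) (begin
    a ⊕ ⊖ b ⊕ c          ≡⟨ ⊕-assoc a (⊖ b) c ⟩
    a ⊕ (⊖ b ⊕ c)        ≡⟨ cong (λ z → a ⊕ (⊖ b ⊕ z)) (⁻¹-involutive c) ⟨
    a ⊕ (⊖ b ⊕ ⊖ ⊖ c)    ≡⟨ cong (a ⊕_) (⁻¹-∙-comm b (⊖ c)) ⟩
    a ⊕ ⊖ (b ⊕ ⊖ c)      ∎)
    where open ≡-Reasoning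

  ⋆-identityˡ : ∀ x → ι ⋆ x ≡ x
  ⋆-identityˡ (s , b) = cong (s ,_) (⊕-identityˡ b)

  ⋆-identityʳ : ∀ x → x ⋆ ι ≡ x
  ⋆-identityʳ (zero     , a) = cong (zero ,_) (⊕-identityʳ a)
  ⋆-identityʳ (suc zero , a) = cong (suc zero ,_) (trans (cong (a ⊕_) ε⁻¹≈ε) (⊕-identityʳ a))

  ⋆-inverseˡ : ∀ x → x ⁻¹ ⋆ x ≡ ι
  ⋆-inverseˡ (zero     , a) = cong (zero ,_) (⊕-inverseˡ a)
  ⋆-inverseˡ (suc zero , a) = cong (zero ,_) (⊕-inverseʳ a)

  ⋆-inverseʳ : ∀ x → x ⋆ x ⁻¹ ≡ ι
  ⋆-inverseʳ (zero     , a) = cong (zero ,_) (⊕-inverseʳ a)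
  ⋆-inverseʳ (suc zero , a) = cong (zero ,_) (⊕-inverseʳ a)

  isGroup : IsGroup _≡_ _⋆_ ι _⁻¹
  isGroup = record
    { isMonoid = record
      { isSemigroup = record
        { isMagma = record { isEquivalence = isEquivalence ; ∙-cong = cong₂ _⋆_ }
        ; assoc   = ⋆-assoc }
      ; identity = ⋆-identityˡ , ⋆-identityʳ }
    ; inverse = ⋆-inverseˡ , ⋆-inverseʳ
    ; ⁻¹-cong = cong _⁻¹ }

  ⋆-noncomm : 2 < m → (zero , ⟦ 1 ⟧) ⋆ (suc zero , 𝟘) ≢ (suc zero , 𝟘) ⋆ (zero , ⟦ 1 ⟧)
  ⋆-noncomm 2<m eq = 1+n≢0 (⟦a⟧≡⊖⟦b⟧⇒a+b≡0 2<m (begin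
    ⟦ 1 ⟧                 ≡⟨ ⊕-identityʳ ⟦ 1 ⟧ ⟨
    ⟦ 1 ⟧ ⊕ 𝟘             ≡⟨ cong proj₂ eq ⟩
    𝟘 ⊕ ⊖ ⟦ 1 ⟧           ≡⟨ ⊕-identityˡ (⊖ ⟦ 1 ⟧) ⟩
    ⊖ ⟦ 1 ⟧               ∎))
    where open ≡-Reasoning

-- The three SEDFs

private
  standard-digits : ∀ R Q s → suc (R + Q * (Q + s)) + (Q + s) * s ≡ R + ((Q + s) * (Q + s) + 1)
  standard-digits = solve-∀

module StandardSEDF (k : ℕ) .{{_ : NonZero k}} where
  open Cyclic (k * k + 1) {{n+1-nonZero}}

  multiple : ℕ → Fin (k * k + 1)
  multiple j = ⟦ k * suc j ⟧

  A : Fin 2 → Subset (k * k + 1)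
  A zero       = image ⟦_⟧ k
  A (suc zero) = image multiple k

  <k⇒<N : ∀ {j} → j < k → j < k * k + 1
  <k⇒<N j<k = m≤n⇒m<n+1 (≤-trans (<⇒≤ j<k) (m≤m*n k k))

  k*[1+j]<N : ∀ {j} → j < k → k * suc j < k * k + 1
  k*[1+j]<N j<k = m≤n⇒m<n+1 (*-monoʳ-≤ k j<k)

  size : ∀ i → ∣ A i ∣ ≡ k
  size zero       = ∣image∣≡ ⟦_⟧ k (λ i<k j<k → ⟦⟧-injective (<k⇒<N i<k) (<k⇒<N j<k))
  size (suc zero) = ∣image∣≡ multiple k (λ i<k j<k →
    suc-injective ∘ *-cancelˡ-≡ _ _ k ∘ ⟦⟧-injective (k*[1+j]<N i<k) (k*[1+j]<N j<k))

  disjoint : ∀ x → x ∈ A zero → x ∉ A (suc zero)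
  disjoint x x∈A₀ x∈A₁ with ∈image⁻ ⟦_⟧ k x∈A₀ | ∈image⁻ multiple k x∈A₁
  ... | i , i<k , refl | j , j<k , kj≡i = <-irrefl refl (begin-strict
    k               ≤⟨ m≤m*n k (suc j) ⟩
    k * suc j       ≡⟨ ⟦⟧-injective (k*[1+j]<N j<k) (<k⇒<N i<k) kj≡i ⟩
    i               <⟨ i<k ⟩
    k               ∎)
    where open ≤-Reasoning

  cover : CoversDifferences cyclicGroup (A zero) (A (suc zero))
  cover g g≢𝟘 with ⟦suc⟧-onto-≢𝟘 g g≢𝟘
  ... | r , 1+r<N , refl = ⟦ R ⟧ , multiple j , ∈image⁺ ⟦_⟧ (m%n<n r k) , ∈image⁺ multiple j<k ,
                            ⊕⊖-cancel (begin
    ⟦ R ⟧                         ≡⟨ ⟦a+N⟧≡⟦a⟧ R ⟨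
    ⟦ R + (k * k + 1) ⟧           ≡⟨ cong ⟦_⟧ digits ⟨
    ⟦ suc r + k * suc j ⟧         ≡⟨ ⟦⟧-homo-+ (suc r) (k * suc j) ⟩
    ⟦ suc r ⟧ ⊕ multiple j        ∎)
    where
    open ≡-Reasoning
    R Q j : ℕ
    R = r % k
    Q = r / k
    j = k ∸ suc Q
    Q<k : Q < k
    Q<k = m<n*o⇒m/o<n (m<n+1⇒m≤n 1+r<N)
    j<k : j < k
    j<k = ∸-monoʳ-< (s≤s z≤n) Q<k
    Q+[1+j]≡k : Q + suc j ≡ k
    Q+[1+j]≡k = trans (+-suc Q j) (m+[n∸m]≡n Q<k)
    digits : suc r + k * suc j ≡ R + (k * k + 1)
    digits = begin
      suc r + k * suc j                                ≡⟨ cong (λ t → suc t + k * suc j) (m≡m%n+[m/n]*n r k) ⟩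
      suc (R + Q * k) + k * suc j
        ≡⟨ cong (λ k′ → suc (R + Q * k′) + k′ * suc j) Q+[1+j]≡k ⟨
      suc (R + Q * (Q + suc j)) + (Q + suc j) * suc j  ≡⟨ standard-digits R Q (suc j) ⟩
      R + ((Q + suc j) * (Q + suc j) + 1)              ≡⟨ cong (λ k′ → R + (k′ * k′ + 1)) Q+[1+j]≡k ⟩
      R + (k * k + 1)                                  ∎

  sedf : SEDF (k * k + 1) 2 k 1
  sedf = record { group = cyclicGroup ; sets = A ; isSEDF = isSEDF-fromCover cyclicGroup A size disjoint cover }

  progression : ∀ i → Progression cyclicGroup k (A i)
  progression zero = record
    { term     = ⟦_⟧
    ; step     = ⟦ 1 ⟧
    ; step≢e   = (λ ()) ∘ ⟦⟧-injective 1<N 0<N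
    ; term-suc = λ j → trans (cong ⟦_⟧ (+-comm 1 j)) (⟦⟧-homo-+ j 1)
    ; term∈    = ∈image⁺ ⟦_⟧
    }
    where
    0<N = m≤n⇒m<n+1 (z≤n {k * k})
    1<N = m≤n⇒m<n+1 (≤-trans (>-nonZero⁻¹ k) (m≤m*n k k))
  progression (suc zero) = record
    { term     = multiple
    ; step     = multiple 0
    ; step≢e   = ≢-nonZero⁻¹ k ∘ trans (sym (*-identityʳ k)) ∘ ⟦⟧-injective (k*[1+j]<N (>-nonZero⁻¹ k)) 0<N
    ; term-suc = λ j → trans (cong ⟦_⟧ (trans (cong (k *_) (+-comm 1 (suc j))) (*-distribˡ-+ k (suc j) 1)))
                             (⟦⟧-homo-+ (k * suc j) (k * 1))
    ; term∈    = ∈image⁺ multiple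
    }
    where
    0<N = m≤n⇒m<n+1 (z≤n {k * k})
private
  radix-budget : ∀ t₁ → let k = suc t₁ + suc t₁ in
    (1 + k * t₁) + (suc (2 * t₁) + suc t₁ * k) ≡ k * k
  radix-budget = solve-∀

  radix-double-budget : ∀ t₁ → let k = suc t₁ + suc t₁ in
    (1 + k * t₁) + (1 + k * t₁) + (4 * t₁ + 2) ≡ k * k
  radix-double-budget = solve-∀

  radix-digits : ∀ e u s v t → let k = t + t in
    (e + k * s) + (suc (2 * u) + v * (t * k)) ≡ suc ((e + u * 2) + (s + v * t) * k)
  radix-digits = solve-∀

  digitwise-+ : ∀ a b c d K → (a + K * b) + (c + K * d) ≡ (a + c) + K * (b + d)
  digitwise-+ = solve-∀

module RadixSEDF (t₁ : ℕ) where
  t k : ℕ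
  t = suc t₁
  k = t + t

  open Cyclic (k * k + 1)

  low : ℕ → ℕ → ℕ
  low e s = e + k * s

  high : ℕ → ℕ → ℕ
  high u v = suc (2 * u) + v * (t * k)

  -- Every 1 ≤ r ≤ k² is low e s + high u v for exactly one choice of digits
  -- e < 2, s < t, u < t, v < 2, namely r − 1 = (e + 2 u) + k (s + t v).
  A : Fin 2 → Subset (k * k + 1)
  A zero       = image (λ s → ⟦ low 0 s ⟧) t ∪ image (λ s → ⟦ low 1 s ⟧) t
  A (suc zero) = image (λ u → ⊖ ⟦ high u 0 ⟧) t ∪ image (λ u → ⊖ ⟦ high u 1 ⟧) t

  t<k : t < k
  t<k = s≤s (m≤n+m t t₁)

  k≡2*t : k ≡ 2 * t
  k≡2*t = cong (t +_) (sym (+-identityʳ t))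

  2≤k : 2 ≤ k
  2≤k = ≤-trans (s≤s (s≤s z≤n)) t<k

  low≤ : ∀ {e s} → e < 2 → s < t → low e s ≤ 1 + k * t₁
  low≤ e<2 s<t = +-mono-≤ (m<1+n⇒m≤n e<2) (*-monoʳ-≤ k (m<1+n⇒m≤n s<t))

  high≤ : ∀ {u v} → u < t → v < 2 → high u v ≤ suc (2 * t₁) + t * k
  high≤ u<t v<2 = +-mono-≤ (s≤s (*-monoʳ-≤ 2 (m<1+n⇒m≤n u<t)))
                           (≤-trans (*-monoˡ-≤ (t * k) (m<1+n⇒m≤n v<2)) (≤-reflexive (+-identityʳ (t * k))))

  low+high<N : ∀ {e s u v} → e < 2 → s < t → u < t → v < 2 → low e s + high u v < k * k + 1
  low+high<N e<2 s<t u<t v<2 =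
    m≤n⇒m<n+1 (≤-trans (+-mono-≤ (low≤ e<2 s<t) (high≤ u<t v<2)) (≤-reflexive (radix-budget t₁)))

  low<N : ∀ {e s} → e < 2 → s < t → low e s < k * k + 1
  low<N e<2 s<t = ≤-<-trans (m≤m+n _ _) (low+high<N {u = 0} {v = 0} e<2 s<t (s≤s z≤n) (s≤s z≤n))

  high<N : ∀ {u v} → u < t → v < 2 → high u v < k * k + 1
  high<N u<t v<2 = ≤-<-trans (m≤n+m _ _) (low+high<N {e = 0} {s = 0} (s≤s z≤n) (s≤s z≤n) u<t v<2)

  low-injective : ∀ {e s e′ s′} → e < 2 → s < t → e′ < 2 → s′ < t →
                  ⟦ low e s ⟧ ≡ ⟦ low e′ s′ ⟧ → e ≡ e′ × s ≡ s′
  low-injective e<2 s<t e′<2 s′<t =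
    digits-unique (<-≤-trans e<2 2≤k) (<-≤-trans e′<2 2≤k) ∘ ⟦⟧-injective (low<N e<2 s<t) (low<N e′<2 s′<t)

  1+2u<t*k : ∀ {u} → u < t → suc (2 * u) < t * k
  1+2u<t*k {u} u<t = begin-strict
    suc (2 * u)     <⟨ n<1+n _ ⟩
    2 + 2 * u       ≡⟨ *-suc 2 u ⟨
    2 * suc u       ≤⟨ *-monoʳ-≤ 2 u<t ⟩
    2 * t           ≡⟨ k≡2*t ⟨
    k               ≤⟨ m≤n*m k t ⟩
    t * k           ∎
    where open ≤-Reasoning

  high-injective : ∀ {u v u′ v′} → u < t → v < 2 → u′ < t → v′ < 2 →
                   ⊖ ⟦ high u v ⟧ ≡ ⊖ ⟦ high u′ v′ ⟧ → u ≡ u′ × v ≡ v′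
  high-injective {u} {v} {u′} {v′} u<t v<2 u′<t v′<2 eq =
    *-cancelˡ-≡ u u′ 2 (suc-injective (proj₁ digits≡)) , proj₂ digits≡
    where
    high≡ : high u v ≡ high u′ v′
    high≡ = ⟦⟧-injective (high<N u<t v<2) (high<N u′<t v′<2) (⁻¹-injective eq)
    digits≡ : suc (2 * u) ≡ suc (2 * u′) × v ≡ v′
    digits≡ = digits-unique (1+2u<t*k u<t) (1+2u<t*k u′<t)
      (trans (cong (suc (2 * u) +_) (*-comm (t * k) v))
      (trans high≡ (cong (suc (2 * u′) +_) (*-comm v′ (t * k)))))

  ∈A₀⁺ : ∀ {e s} → e < 2 → s < t → ⟦ low e s ⟧ ∈ A zero
  ∈A₀⁺ {0} _ s<t = x∈p∪q⁺ (inj₁ (∈image⁺ (λ s → ⟦ low 0 s ⟧) s<t))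
  ∈A₀⁺ {1} _ s<t = x∈p∪q⁺ (inj₂ (∈image⁺ (λ s → ⟦ low 1 s ⟧) s<t))
  ∈A₀⁺ {suc (suc _)} (s≤s (s≤s ()))

  ∈A₁⁺ : ∀ {u v} → u < t → v < 2 → ⊖ ⟦ high u v ⟧ ∈ A (suc zero)
  ∈A₁⁺ {v = 0} u<t _ = x∈p∪q⁺ (inj₁ (∈image⁺ (λ u → ⊖ ⟦ high u 0 ⟧) u<t))
  ∈A₁⁺ {v = 1} u<t _ = x∈p∪q⁺ (inj₂ (∈image⁺ (λ u → ⊖ ⟦ high u 1 ⟧) u<t))
  ∈A₁⁺ {v = suc (suc _)} _ (s≤s (s≤s ()))

  ∈A₀⁻ : ∀ {x} → x ∈ A zero → ∃₂ λ e s → e < 2 × s < t × ⟦ low e s ⟧ ≡ x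
  ∈A₀⁻ x∈A₀ with x∈p∪q⁻ _ _ x∈A₀
  ... | inj₁ x∈ = let s , s<t , eq = ∈image⁻ _ t x∈ in 0 , s , s≤s z≤n , s<t , eq
  ... | inj₂ x∈ = let s , s<t , eq = ∈image⁻ _ t x∈ in 1 , s , ≤-refl , s<t , eq

  ∈A₁⁻ : ∀ {x} → x ∈ A (suc zero) → ∃₂ λ u v → u < t × v < 2 × ⊖ ⟦ high u v ⟧ ≡ x
  ∈A₁⁻ x∈A₁ with x∈p∪q⁻ _ _ x∈A₁
  ... | inj₁ x∈ = let u , u<t , eq = ∈image⁻ _ t x∈ in u , 0 , u<t , s≤s z≤n , eq
  ... | inj₂ x∈ = let u , u<t , eq = ∈image⁻ _ t x∈ in u , 1 , u<t , ≤-refl , eq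

  size : ∀ i → ∣ A i ∣ ≡ k
  size zero       = ∣image∪image∣≡ _ _ t t
    (λ i<t j<t → proj₂ ∘ low-injective z≤1 i<t z≤1 j<t)
    (λ i<t j<t → proj₂ ∘ low-injective 1≤1 i<t 1≤1 j<t)
    (λ i<t j<t → (λ ()) ∘ proj₁ ∘ low-injective z≤1 i<t 1≤1 j<t)
    where z≤1 = s≤s z≤n; 1≤1 = ≤-refl
  size (suc zero) = ∣image∪image∣≡ _ _ t t
    (λ i<t j<t → proj₁ ∘ high-injective i<t z≤1 j<t z≤1)
    (λ i<t j<t → proj₁ ∘ high-injective i<t 1≤1 j<t 1≤1)
    (λ i<t j<t → (λ ()) ∘ proj₂ ∘ high-injective i<t z≤1 j<t 1≤1)
    where z≤1 = s≤s z≤n; 1≤1 = ≤-refl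

  disjoint : ∀ x → x ∈ A zero → x ∉ A (suc zero)
  disjoint x x∈A₀ x∈A₁ with ∈A₀⁻ x∈A₀ | ∈A₁⁻ x∈A₁
  ... | e , s , e<2 , s<t , refl | u , v , u<t , v<2 , eq =
    m+1+n≢0 (low e s) (⟦a⟧≡⊖⟦b⟧⇒a+b≡0 {low e s} {high u v} (low+high<N e<2 s<t u<t v<2) (sym eq))

  cover : CoversDifferences cyclicGroup (A zero) (A (suc zero))
  cover g g≢𝟘 with ⟦suc⟧-onto-≢𝟘 g g≢𝟘
  ... | r , 1+r<N , refl = ⟦ low e s ⟧ , ⊖ ⟦ high u v ⟧ , ∈A₀⁺ e<2 s<t , ∈A₁⁺ u<t v<2 , (begin
    ⟦ low e s ⟧ ⊕ ⊖ ⊖ ⟦ high u v ⟧     ≡⟨ cong (⟦ low e s ⟧ ⊕_) (⁻¹-involutive _) ⟩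
    ⟦ low e s ⟧ ⊕ ⟦ high u v ⟧         ≡⟨ ⟦⟧-homo-+ (low e s) (high u v) ⟨
    ⟦ low e s + high u v ⟧             ≡⟨ cong ⟦_⟧ digits ⟩
    ⟦ suc r ⟧                          ∎)
    where
    R Q e u s v : ℕ
    R = r % k
    Q = r / k
    e = R % 2
    u = R / 2
    s = Q % t
    v = Q / t
    e<2 : e < 2
    e<2 = m%n<n R 2
    u<t : u < t
    u<t = m<n*o⇒m/o<n (subst (R <_) (trans k≡2*t (*-comm 2 t)) (m%n<n r k))
    s<t : s < t
    s<t = m%n<n Q t
    v<2 : v < 2
    v<2 = m<n*o⇒m/o<n (subst (Q <_) k≡2*t (m<n*o⇒m/o<n (m<n+1⇒m≤n 1+r<N)))
    digits : low e s + high u v ≡ suc r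
    digits = begin
      low e s + high u v                 ≡⟨ radix-digits e u s v t ⟩
      suc ((e + u * 2) + (s + v * t) * k) ≡⟨ cong (λ z → suc (z + (s + v * t) * k)) (m≡m%n+[m/n]*n R 2) ⟨
      suc (R + (s + v * t) * k)          ≡⟨ cong (λ z → suc (R + z * k)) (m≡m%n+[m/n]*n Q t) ⟨
      suc (R + Q * k)                    ≡⟨ cong suc (m≡m%n+[m/n]*n r k) ⟨
      suc r                              ∎
      where open ≡-Reasoning
    open ≡-Reasoning

  sedf : SEDF (k * k + 1) 2 k 1
  sedf = record { group = cyclicGroup ; sets = A ; isSEDF = isSEDF-fromCover cyclicGroup A size disjoint cover }

  module ProgressionDigits (1≤t₁ : 1 ≤ t₁) (P : Progression cyclicGroup k (A zero)) where
    open Progression P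

    2<k : 2 < k
    2<k = s≤s (≤-trans (s≤s 1≤t₁) (m≤n+m t t₁))

    V E S : ℕ → ℕ
    V j = toℕ (term j)
    E j = V j % k
    S j = V j / k

    V≡ : ∀ j → V j ≡ E j + k * S j
    V≡ j = trans (m≡m%n+[m/n]*n (V j) k) (cong (E j +_) (*-comm (S j) k))

    digits< : ∀ {j} → j < k → E j < 2 × S j < t
    digits< {j} j<k =
      let e , s , e<2 , s<t , low≡term = ∈A₀⁻ (term∈ j<k)
          E≡e , S≡s = digits-unique (m%n<n (V j) k) (<-≤-trans e<2 2≤k)
                        (trans (sym (V≡ j)) (trans (cong toℕ (sym low≡term)) (toℕ-⟦⟧< (low<N e<2 s<t))))
      in subst (_< 2) (sym E≡e) e<2 , subst (_< t) (sym S≡s) s<t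

    V≤ : ∀ {j} → j < k → V j ≤ 1 + k * t₁
    V≤ {j} j<k = subst (_≤ 1 + k * t₁) (sym (V≡ j)) (low≤ (proj₁ (digits< j<k)) (proj₂ (digits< j<k)))

    V+V<N : ∀ {i j} → i < k → j < k → V i + V j < k * k + 1
    V+V<N i<k j<k = m≤n⇒m<n+1 (≤-trans (+-mono-≤ (V≤ i<k) (V≤ j<k))
                                       (≤-trans (m≤m+n _ _) (≤-reflexive (radix-double-budget t₁))))

    V-midpoint : ∀ {j} → suc (suc j) < k → V (suc (suc j)) + V j ≡ V (suc j) + V (suc j)
    V-midpoint {j} 2+j<k = begin
      V (suc (suc j)) + V j                ≡⟨ toℕ-⟦⟧< (V+V<N 2+j<k j<k) ⟨
      toℕ (term (suc (suc j)) ⊕ term j)    ≡⟨ cong toℕ (progression-midpoint ⊕-comm P j) ⟩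
      toℕ (term (suc j) ⊕ term (suc j))    ≡⟨ toℕ-⟦⟧< (V+V<N 1+j<k 1+j<k) ⟩
      V (suc j) + V (suc j)                ∎
      where
      open ≡-Reasoning
      1+j<k = ≤-trans (n≤1+n _) 2+j<k
      j<k   = ≤-trans (n≤1+n _) 1+j<k

    digits-midpoint : ∀ {j} → suc (suc j) < k →
      E (suc (suc j)) + E j ≡ E (suc j) + E (suc j) × S (suc (suc j)) + S j ≡ S (suc j) + S (suc j)
    digits-midpoint {j} 2+j<k = digits-unique (E+E<k 2+j<k j<k) (E+E<k 1+j<k 1+j<k) (begin
      (E (2 + j) + E j) + k * (S (2 + j) + S j)     ≡⟨ digitwise-+ (E (2 + j)) (S (2 + j)) (E j) (S j) k ⟨
      (E (2 + j) + k * S (2 + j)) + (E j + k * S j) ≡⟨ cong₂ _+_ (V≡ (2 + j)) (V≡ j) ⟨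
      V (2 + j) + V j                               ≡⟨ V-midpoint 2+j<k ⟩
      V (1 + j) + V (1 + j)                         ≡⟨ cong₂ _+_ (V≡ (1 + j)) (V≡ (1 + j)) ⟩
      (E (1 + j) + k * S (1 + j)) + (E (1 + j) + k * S (1 + j))
        ≡⟨ digitwise-+ (E (1 + j)) (S (1 + j)) (E (1 + j)) (S (1 + j)) k ⟩
      (E (1 + j) + E (1 + j)) + k * (S (1 + j) + S (1 + j)) ∎)
      where
      open ≡-Reasoning
      1+j<k = ≤-trans (n≤1+n _) 2+j<k
      j<k   = ≤-trans (n≤1+n _) 1+j<k
      E+E<k : ∀ {a b} → a < k → b < k → E a + E b < k
      E+E<k a<k b<k =
        ≤-trans (s≤s (+-mono-≤ (m<1+n⇒m≤n (proj₁ (digits< a<k))) (m<1+n⇒m≤n (proj₁ (digits< b<k))))) 2<k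

    S-midpoint : ∀ j → suc (suc j) ≤ t → S (suc (suc j)) + S j ≡ S (suc j) + S (suc j)
    S-midpoint j 2+j≤t = proj₂ (digits-midpoint (≤-<-trans 2+j≤t t<k))

    S₁≢S₀ : S 1 ≢ S 0
    S₁≢S₀ S₁≡S₀ = step≢e (identityʳ-unique (term 0) step (trans (sym (term-suc 0)) term₁≡term₀))
      where
      open GroupProperties (asGroup cyclicGroup) using (identityʳ-unique)
      E₀≡E₁ : E 0 ≡ E 1
      E₀≡E₁ = midpoint-bit (proj₁ (digits< (<-trans (s≤s z≤n) 2<k)))
                           (proj₁ (digits< (<-trans (s≤s (s≤s z≤n)) 2<k)))
                           (proj₁ (digits< 2<k))
                           (proj₁ (digits-midpoint 2<k))
      term₁≡term₀ : term 1 ≡ term 0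
      term₁≡term₀ = toℕ-injective
        (trans (V≡ 1) (trans (cong₂ (λ a b → a + k * b) (sym E₀≡E₁) S₁≡S₀) (sym (V≡ 0))))

  no-progression : 1 ≤ t₁ → ¬ Progression cyclicGroup k (A zero)
  no-progression 1≤t₁ P = nonconstant-progression-unbounded S t S-midpoint S₁≢S₀
                            (λ j j≤t → proj₂ (digits< (≤-<-trans j≤t t<k)))
    where open ProgressionDigits 1≤t₁ P

private
  dihedral-order : ∀ q → let k = suc (q + q) in k * k + 1 ≡ 2 * suc (k * q + q)
  dihedral-order = solve-∀

  rotation-digits : ∀ a q K → a + (suc q + K) ≡ suc ((a + q) + K)
  rotation-digits = solve-∀

  reflection-digits₁ : ∀ r c R K → r + (suc (suc c + R) + K) ≡ suc c + (r + suc (R + K))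
  reflection-digits₁ = solve-∀

  reflection-digits₂ : ∀ r a R Q → let k = suc (a + R) in r + k * suc Q ≡ a + (r + suc (R + k * Q))
  reflection-digits₂ = solve-∀

module DihedralSEDF (q : ℕ) where
  k p m : ℕ
  k = suc (q + q)
  p = suc q
  m = suc (k * q + q)

  open Cyclic m
  open Dihedral m

  -- Opaque: unfolding *↔× at these indices makes type checking very slow.
  opaque
    coordinates : Fin (k * k + 1) ↔ (Fin 2 × Fin m)
    coordinates = subst (λ n → Fin n ↔ (Fin 2 × Fin m)) (sym (dihedral-order q)) *↔×

  open Inverse coordinates using (to; from; strictlyInverseʳ)
  open Transport coordinates isGroup
  open FinGroup transportedGroup

  rot ref : Fin m → Fin (k * k + 1)
  rot a = from (zero , a)
  ref a = from (suc zero , a)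

  rA fA rB fB : ℕ → Fin (k * k + 1)
  rA a = rot ⟦ a ⟧
  fA c = ref ⟦ suc c ⟧
  rB j = rot (⊖ ⟦ p + k * j ⟧)
  fB j = ref (⊖ ⟦ k * j ⟧)

  -- The quotients x y⁻¹ are the rotations by a + p + k j and c + 1 + k j, which
  -- run through 1, …, m − 1, and the reflections by a − k j and c − q − k j,
  -- which exhaust ℤ/m.
  A : Fin 2 → Subset (k * k + 1)
  A zero       = image rA p ∪ image fA q
  A (suc zero) = image rB q ∪ image fB p

  rot-injective : ∀ {x y} → rot x ≡ rot y → x ≡ y
  rot-injective = cong proj₂ ∘ from-injective

  ref-injective : ∀ {x y} → ref x ≡ ref y → x ≡ y
  ref-injective = cong proj₂ ∘ from-injective

  rot≢ref : ∀ {x y} → rot x ≢ ref y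
  rot≢ref = (λ ()) ∘ cong proj₁ ∘ from-injective

  <m : ∀ {a} → a ≤ q + k * q → a < m
  <m a≤ = s≤s (≤-trans a≤ (≤-reflexive (+-comm q (k * q))))

  k*j<k*q : ∀ {j} → j < q → suc (k * j) ≤ k * q
  k*j<k*q {j} j<q = begin
    suc (k * j)   ≤⟨ +-monoˡ-≤ (k * j) (s≤s (z≤n {q + q})) ⟩
    k + k * j     ≡⟨ *-suc k j ⟨
    k * suc j     ≤⟨ *-monoʳ-≤ k j<q ⟩
    k * q         ∎
    where open ≤-Reasoning

  rA<m : ∀ {a} → a < p → a < m
  rA<m a<p = <m (≤-trans (m<1+n⇒m≤n a<p) (m≤m+n q (k * q)))

  fA<m : ∀ {c} → c < q → suc c < m
  fA<m c<q = <m (≤-trans c<q (m≤m+n q (k * q)))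

  rB<m : ∀ {j} → j < q → p + k * j < m
  rB<m {j} j<q = <m (≤-trans (≤-reflexive (sym (+-suc q (k * j)))) (+-monoʳ-≤ q (k*j<k*q j<q)))

  fB<m : ∀ {j} → j < p → k * j < m
  fB<m j<p = <m (≤-trans (*-monoʳ-≤ k (m<1+n⇒m≤n j<p)) (m≤n+m (k * q) q))

  size : ∀ i → ∣ A i ∣ ≡ k
  size zero       = ∣image∪image∣≡ rA fA p q
    (λ i<p j<p → ⟦⟧-injective (rA<m i<p) (rA<m j<p) ∘ rot-injective)
    (λ i<q j<q → suc-injective ∘ ⟦⟧-injective (fA<m i<q) (fA<m j<q) ∘ ref-injective)
    (λ _ _ → rot≢ref)
  size (suc zero) = trans (∣image∪image∣≡ rB fB q p
    (λ i<q j<q → *-cancelˡ-≡ _ _ k ∘ +-cancelˡ-≡ p _ _ ∘ ⟦⟧-injective (rB<m i<q) (rB<m j<q)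
                                    ∘ ⁻¹-injective ∘ rot-injective)
    (λ i<p j<p → *-cancelˡ-≡ _ _ k ∘ ⟦⟧-injective (fB<m i<p) (fB<m j<p) ∘ ⁻¹-injective ∘ ref-injective)
    (λ _ _ → rot≢ref))
    (+-suc q q)

  disjoint : ∀ x → x ∈ A zero → x ∉ A (suc zero)
  disjoint x x∈A₀ x∈A₁ with x∈p∪q⁻ _ _ x∈A₀ | x∈p∪q⁻ _ _ x∈A₁
  ... | inj₁ x∈rA | inj₁ x∈rB with ∈image⁻ rA p x∈rA | ∈image⁻ rB q x∈rB
  ...   | a , a<p , refl | j , j<q , rBj≡rAa =
    m+1+n≢0 a (⟦a⟧≡⊖⟦b⟧⇒a+b≡0 {a} {p + k * j} (<m a+p+kj≤) (sym (rot-injective rBj≡rAa)))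
    where
    a+p+kj≤ : a + (p + k * j) ≤ q + k * q
    a+p+kj≤ = begin
      a + (p + k * j)       ≤⟨ +-monoˡ-≤ (p + k * j) (m<1+n⇒m≤n a<p) ⟩
      q + (suc q + k * j)   ≡⟨ +-assoc q (suc q) (k * j) ⟨
      q + suc q + k * j     ≡⟨ cong (_+ k * j) (+-suc q q) ⟩
      k + k * j             ≡⟨ *-suc k j ⟨
      k * suc j             ≤⟨ *-monoʳ-≤ k j<q ⟩
      k * q                 ≤⟨ m≤n+m (k * q) q ⟩
      q + k * q             ∎
      where open ≤-Reasoning
  disjoint x x∈A₀ x∈A₁ | inj₁ x∈rA | inj₂ x∈fB with ∈image⁻ rA p x∈rA | ∈image⁻ fB p x∈fB
  ...   | _ , _ , refl | _ , _ , fBj≡rAa = rot≢ref (sym fBj≡rAa)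
  disjoint x x∈A₀ x∈A₁ | inj₂ x∈fA | inj₁ x∈rB with ∈image⁻ fA q x∈fA | ∈image⁻ rB q x∈rB
  ...   | _ , _ , refl | _ , _ , rBj≡fAc = rot≢ref rBj≡fAc
  disjoint x x∈A₀ x∈A₁ | inj₂ x∈fA | inj₂ x∈fB with ∈image⁻ fA q x∈fA | ∈image⁻ fB p x∈fB
  ...   | c , c<q , refl | j , j<p , fBj≡fAc =
    1+n≢0 (⟦a⟧≡⊖⟦b⟧⇒a+b≡0 {suc c} {k * j}
              (<m (+-mono-≤ c<q (*-monoʳ-≤ k (m<1+n⇒m≤n j<p)))) (sym (ref-injective fBj≡fAc)))

  Covered : Fin (k * k + 1) → Set
  Covered = IsDifference transportedGroup (A zero) (A (suc zero))

  rA∈ : ∀ {a} → a < p → rA a ∈ A zero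
  rA∈ a<p = x∈p∪q⁺ (inj₁ (∈image⁺ rA a<p))

  fA∈ : ∀ {c} → c < q → fA c ∈ A zero
  fA∈ c<q = x∈p∪q⁺ (inj₂ (∈image⁺ fA c<q))

  rB∈ : ∀ {j} → j < q → rB j ∈ A (suc zero)
  rB∈ j<q = x∈p∪q⁺ (inj₁ (∈image⁺ rB j<q))

  fB∈ : ∀ {j} → j < p → fB j ∈ A (suc zero)
  fB∈ j<p = x∈p∪q⁺ (inj₂ (∈image⁺ fB j<p))

  rA·rB⁻¹ : ∀ a j → rA a · inv (rB j) ≡ rot ⟦ a + (p + k * j) ⟧
  rA·rB⁻¹ a j = trans (from-homo-inv (zero , ⟦ a ⟧) (zero , ⊖ ⟦ p + k * j ⟧))
                      (cong rot (trans (cong (⟦ a ⟧ ⊕_) (⁻¹-involutive _)) (sym (⟦⟧-homo-+ a (p + k * j)))))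

  fA·fB⁻¹ : ∀ c j → fA c · inv (fB j) ≡ rot ⟦ suc c + k * j ⟧
  fA·fB⁻¹ c j = trans (from-homo-inv (suc zero , ⟦ suc c ⟧) (suc zero , ⊖ ⟦ k * j ⟧))
                      (cong rot (trans (cong (⟦ suc c ⟧ ⊕_) (⁻¹-involutive _)) (sym (⟦⟧-homo-+ (suc c) (k * j)))))

  rA·fB⁻¹ : ∀ a j → rA a · inv (fB j) ≡ ref (⟦ a ⟧ ⊕ ⊖ ⟦ k * j ⟧)
  rA·fB⁻¹ a j = from-homo-inv (zero , ⟦ a ⟧) (suc zero , ⊖ ⟦ k * j ⟧)

  fA·rB⁻¹ : ∀ c j → fA c · inv (rB j) ≡ ref (⟦ suc c ⟧ ⊕ ⊖ ⟦ p + k * j ⟧)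
  fA·rB⁻¹ c j = trans (from-homo-inv (suc zero , ⟦ suc c ⟧) (zero , ⊖ ⟦ p + k * j ⟧))
                      (cong (λ z → ref (⟦ suc c ⟧ ⊕ z)) (⁻¹-involutive _))

  <m⁻¹ : ∀ {a} → a < m → a ≤ q + k * q
  <m⁻¹ (s≤s a≤) = ≤-trans a≤ (≤-reflexive (+-comm (k * q) q))

  module Rotation (r : ℕ) (1+r<m : suc r < m) where
    R Q : ℕ
    R = r % k
    Q = r / k

    r≡R+kQ : r ≡ R + k * Q
    r≡R+kQ = trans (m≡m%n+[m/n]*n r k) (cong (R +_) (*-comm Q k))

    r<q+kq : r < q + k * q
    r<q+kq = <m⁻¹ 1+r<m

    cover-R<q : R < q → Covered (rot ⟦ suc r ⟧)
    cover-R<q R<q = fA R , fB Q , fA∈ R<q , fB∈ Q<p , trans (fA·fB⁻¹ R Q) (cong (rot ∘ ⟦_⟧ ∘ suc) (sym r≡R+kQ))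
      where
      Q<p : Q < p
      Q<p = m<n*o⇒m/o<n (<-≤-trans r<q+kq (+-mono-≤ (≤-trans (m≤m+n q q) (n≤1+n _)) (≤-reflexive (*-comm k q))))

    cover-q≤R : q ≤ R → Covered (rot ⟦ suc r ⟧)
    cover-q≤R q≤R = rA (R ∸ q) , rB Q , rA∈ a<p , rB∈ Q<q , trans (rA·rB⁻¹ (R ∸ q) Q) (cong (rot ∘ ⟦_⟧) digits)
      where
      a<p : R ∸ q < p
      a<p = s≤s (≤-trans (∸-monoˡ-≤ q (m<1+n⇒m≤n (m%n<n r k))) (≤-reflexive (m+n∸n≡m q q)))
      Q<q : Q < q
      Q<q = *-cancelˡ-< k Q q (+-cancelˡ-< q _ _
              (≤-<-trans (+-monoˡ-≤ (k * Q) q≤R) (subst (_< q + k * q) r≡R+kQ r<q+kq)))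
      digits : R ∸ q + (p + k * Q) ≡ suc r
      digits = begin
        R ∸ q + (suc q + k * Q)     ≡⟨ rotation-digits (R ∸ q) q (k * Q) ⟩
        suc (R ∸ q + q + k * Q)     ≡⟨ cong (λ z → suc (z + k * Q)) (m∸n+n≡m q≤R) ⟩
        suc (R + k * Q)             ≡⟨ cong suc r≡R+kQ ⟨
        suc r                       ∎
        where open ≡-Reasoning

    cover : Covered (rot ⟦ suc r ⟧)
    cover with q ≤? R
    ... | yes q≤R = cover-q≤R q≤R
    ... | no  q≰R = cover-R<q (≰⇒> q≰R)

  reflection-cover-near : ∀ {r} → r ≤ q → Covered (ref ⟦ r ⟧)
  reflection-cover-near {r} r≤q = rA r , fB 0 , rA∈ (s≤s r≤q) , fB∈ (s≤s z≤n) ,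
                                   trans (rA·fB⁻¹ r 0) (cong ref (⊕⊖-cancel (begin
    ⟦ r ⟧               ≡⟨ cong ⟦_⟧ (trans (cong (r +_) (*-zeroʳ k)) (+-identityʳ r)) ⟨
    ⟦ r + k * 0 ⟧       ≡⟨ ⟦⟧-homo-+ r (k * 0) ⟩
    ⟦ r ⟧ ⊕ ⟦ k * 0 ⟧   ∎)))
    where open ≡-Reasoning

  module FarReflection (r : ℕ) (r<m : r < m) (q<r : q < r) where
    u R Q : ℕ
    u = q + k * q ∸ r
    R = u % k
    Q = u / k

    r+1+u≡m : r + suc u ≡ m
    r+1+u≡m = trans (+-suc r u) (cong suc (trans (m+[n∸m]≡n (<m⁻¹ r<m)) (+-comm q (k * q))))

    u≡R+kQ : u ≡ R + k * Q
    u≡R+kQ = trans (m≡m%n+[m/n]*n u k) (cong (R +_) (*-comm Q k))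

    Q<q : Q < q
    Q<q = m<n*o⇒m/o<n (+-cancelˡ-< q u (q * k) (begin-strict
      q + u                 <⟨ +-monoˡ-< u q<r ⟩
      r + u                 ≡⟨ m+[n∸m]≡n (<m⁻¹ r<m) ⟩
      q + k * q             ≡⟨ cong (q +_) (*-comm k q) ⟩
      q + q * k             ∎))
      where open ≤-Reasoning

    cover-R<q : R < q → Covered (ref ⟦ r ⟧)
    cover-R<q R<q = fA c , rB Q , fA∈ c<q , rB∈ Q<q ,
                    trans (fA·rB⁻¹ c Q) (cong ref (⊕⊖-cancel (begin
      ⟦ suc c ⟧                    ≡⟨ ⟦a+N⟧≡⟦a⟧ (suc c) ⟨
      ⟦ suc c + m ⟧                ≡⟨ cong ⟦_⟧ digits ⟨
      ⟦ r + (p + k * Q) ⟧          ≡⟨ ⟦⟧-homo-+ r (p + k * Q) ⟩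
      ⟦ r ⟧ ⊕ ⟦ p + k * Q ⟧        ∎)))
      where
      open ≡-Reasoning
      c = q ∸ suc R
      c<q : c < q
      c<q = ∸-monoʳ-< (s≤s z≤n) R<q
      1+c+R≡q : suc c + R ≡ q
      1+c+R≡q = trans (sym (+-suc c R)) (m∸n+n≡m R<q)
      digits : r + (p + k * Q) ≡ suc c + m
      digits = begin
        r + (suc q + k * Q)                ≡⟨ cong (λ z → r + (suc z + k * Q)) 1+c+R≡q ⟨
        r + (suc (suc c + R) + k * Q)      ≡⟨ reflection-digits₁ r c R (k * Q) ⟩
        suc c + (r + suc (R + k * Q))      ≡⟨ cong (λ z → suc c + (r + suc z)) u≡R+kQ ⟨
        suc c + (r + suc u)                ≡⟨ cong (suc c +_) r+1+u≡m ⟩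
        suc c + m                          ∎

    cover-q≤R : q ≤ R → Covered (ref ⟦ r ⟧)
    cover-q≤R q≤R = rA a , fB (suc Q) , rA∈ a<p , fB∈ (s≤s Q<q) ,
                    trans (rA·fB⁻¹ a (suc Q)) (cong ref (⊕⊖-cancel (begin
      ⟦ a ⟧                        ≡⟨ ⟦a+N⟧≡⟦a⟧ a ⟨
      ⟦ a + m ⟧                    ≡⟨ cong ⟦_⟧ digits ⟨
      ⟦ r + k * suc Q ⟧            ≡⟨ ⟦⟧-homo-+ r (k * suc Q) ⟩
      ⟦ r ⟧ ⊕ ⟦ k * suc Q ⟧        ∎)))
      where
      open ≡-Reasoning
      a = q + q ∸ R
      a+R≡q+q : a + R ≡ q + q
      a+R≡q+q = m∸n+n≡m (m<1+n⇒m≤n (m%n<n u k))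
      a<p : a < p
      a<p = s≤s (≤-trans (∸-monoʳ-≤ (q + q) q≤R) (≤-reflexive (m+n∸n≡m q q)))
      digits : r + k * suc Q ≡ a + m
      digits = begin
        r + suc (q + q) * suc Q               ≡⟨ cong (λ z → r + suc z * suc Q) a+R≡q+q ⟨
        r + suc (a + R) * suc Q               ≡⟨ reflection-digits₂ r a R Q ⟩
        a + (r + suc (R + suc (a + R) * Q))   ≡⟨ cong (λ z → a + (r + suc (R + suc z * Q))) a+R≡q+q ⟩
        a + (r + suc (R + k * Q))             ≡⟨ cong (λ z → a + (r + suc z)) u≡R+kQ ⟨
        a + (r + suc u)                       ≡⟨ cong (a +_) r+1+u≡m ⟩
        a + m                                 ∎

    cover : Covered (ref ⟦ r ⟧)
    cover with q ≤? R
    ... | yes q≤R = cover-q≤R q≤R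
    ... | no  q≰R = cover-R<q (≰⇒> q≰R)

  reflection-cover : ∀ r → r < m → Covered (ref ⟦ r ⟧)
  reflection-cover r r<m with r ≤? q
  ... | yes r≤q = reflection-cover-near r≤q
  ... | no  r≰q = FarReflection.cover r r<m (≰⇒> r≰q)

  cover : CoversDifferences transportedGroup (A zero) (A (suc zero))
  cover g g≢e =
    subst Covered (strictlyInverseʳ g) (cover-coordinates (to g) (g≢e ∘ trans (sym (strictlyInverseʳ g))))
    where
    cover-coordinates : ∀ x → from x ≢ e → Covered (from x)
    cover-coordinates (zero , w) rot-w≢e with ⟦suc⟧-onto-≢𝟘 w (rot-w≢e ∘ cong rot)
    ... | r , 1+r<m , refl = Rotation.cover r 1+r<m
    cover-coordinates (suc zero , w) _ = subst (Covered ∘ ref) (⟦toℕ⟧ w) (reflection-cover (toℕ w) (toℕ<n w))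

  sedf : SEDF (k * k + 1) 2 k 1
  sedf = record
    { group = transportedGroup ; sets = A ; isSEDF = isSEDF-fromCover transportedGroup A size disjoint cover }

  noncommutative : 1 ≤ q → ¬ Commutative _≡_ _·_
  noncommutative 1≤q comm = ⋆-noncomm 2<m (from-injective (begin
    from ((zero , ⟦ 1 ⟧) ⋆ (suc zero , 𝟘))   ≡⟨ from-homo _ _ ⟨
    rot ⟦ 1 ⟧ · ref 𝟘                        ≡⟨ comm (rot ⟦ 1 ⟧) (ref 𝟘) ⟩
    ref 𝟘 · rot ⟦ 1 ⟧                        ≡⟨ from-homo _ _ ⟩
    from ((suc zero , 𝟘) ⋆ (zero , ⟦ 1 ⟧))   ∎))
    where
    open ≡-Reasoning
    2<m : 2 < m
    2<m = s≤s (≤-trans (+-mono-≤ 1≤q 1≤q) (+-monoˡ-≤ q (m≤n*m q k)))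

TwoInequivalentSEDFs : ℕ → Set
TwoInequivalentSEDFs k =
  Σ (SEDF (k * k + 1) 2 k 1) λ D₁ → Σ (SEDF (k * k + 1) 2 k 1) λ D₂ → ¬ Equivalent D₁ D₂

even-case : ∀ t₁ → 1 ≤ t₁ → TwoInequivalentSEDFs (suc t₁ + suc t₁)
even-case t₁ 1≤t₁ = D₁ , D₂ , λ D₁≈D₂ →
  RadixSEDF.no-progression t₁ 1≤t₁
    (equivalent-progression {D₁ = D₁} {D₂} D₁≈D₂ (Cyclic.⊕-comm _) (StandardSEDF.progression _) zero)
  where
  D₁ = StandardSEDF.sedf (suc t₁ + suc t₁)
  D₂ = RadixSEDF.sedf t₁

odd-case : ∀ q → 1 ≤ q → TwoInequivalentSEDFs (suc (q + q))
odd-case q 1≤q = D₁ , D₂ , λ D₁≈D₂ →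
  DihedralSEDF.noncommutative q 1≤q (equivalent-comm {D₁ = D₁} {D₂} D₁≈D₂ (Cyclic.⊕-comm _))
  where
  D₁ = StandardSEDF.sedf (suc (q + q))
  D₂ = DihedralSEDF.sedf q

corollary6p3 : (k : ℕ) → 2 < k →
    Σ (SEDF (k * k + 1) 2 k 1) λ D₁ → Σ (SEDF (k * k + 1) 2 k 1) λ D₂ → ¬ Equivalent D₁ D₂
corollary6p3 k 2<k with even-or-odd k
... | inj₁ (suc (suc t₂) , refl) = even-case (suc t₂) (s≤s z≤n)
... | inj₂ (suc q , refl)        = odd-case (suc q) (s≤s z≤n)
corollary6p3 _ ()                 | inj₁ (0 , refl)
corollary6p3 _ (s≤s (s≤s ()))     | inj₁ (1 , refl)
corollary6p3 _ (s≤s ())           | inj₂ (0 , refl)
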